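{- Let $w\in S_n$ be chosen uniformly at random. For $i,j\in[n]$ let $X_{ij}$ be the indicator of the event $w^{ -1}(i)>w^{ -1}(j)$. Set $L=\sum_{1\le i<j\le n}X_{ij}$, $D=\sum_{i=1}^{n-1}X_{i,i+1}$ and $X=L-\binom{D+1}{2}$. Then $\mathbb{E}[X^2]=\dfrac{n^4}{64}+o(n^4)$ as $n\to\infty$. -}

module Defs where

open import Data.Nat using (ℕ; zero; suc; _+_; _*_; _^_; _!; _<ᵇ_; _≡ᵇ_)
open import Data.Nat.Properties using (_!≢0)
open import Data.Nat.Combinatorics using (_C_)
open import Data.Bool using (if_then_else_)
open import Data.List using (List; []; _∷_; map; concatMap; upTo; foldr)
open import Data.Nat.ListAction using (sum)
open import Data.Integer as ℤ using (ℤ; +_)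
open import Data.Rational as ℚ using (ℚ)

insertAll : {A : Set} → A → List A → List (List A)
insertAll x [] = (x ∷ []) ∷ []
insertAll x (y ∷ ys) = (x ∷ y ∷ ys) ∷ map (y ∷_) (insertAll x ys)

perms : {A : Set} → List A → List (List A)
perms [] = [] ∷ []
perms (x ∷ xs) = concatMap (insertAll x) (perms xs)

[_] : ℕ → List ℕ
[ n ] = map suc (upTo n)

-- S_n: each w is given in one-line notation w(1) w(2) ... w(n);
-- this list contains every permutation of [n] exactly once (n! entries).
Sym : ℕ → List (List ℕ)
Sym n = perms [ n ]

-- w⁻¹(i) = the (1-based) position of the value i in the one-line notation of w
winv : List ℕ → ℕ → ℕ
winv [] i = 0
winv (x ∷ xs) i = if x ≡ᵇ i then 1 else suc (winv xs i)

Xij : List ℕ → ℕ → ℕ → ℕ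
Xij w i j = if winv w j <ᵇ winv w i then 1 else 0

Lstat : ℕ → List ℕ → ℕ
Lstat n w = sum (concatMap (λ j → map (λ i → Xij w i j) (map suc (upTo (j Data.Nat.∸ 1)))) [ n ])
  where import Data.Nat

Dstat : ℕ → List ℕ → ℕ
Dstat n w = sum (map (λ i → Xij w i (suc i)) [ n Data.Nat.∸ 1 ])
  where import Data.Nat

Xstat : ℕ → List ℕ → ℤ
Xstat n w = (+ Lstat n w) ℤ.- (+ (suc (Dstat n w) C 2))

sumXsq : ℕ → ℤ
sumXsq n = foldr ℤ._+_ (+ 0) (map (λ w → Xstat n w ℤ.* Xstat n w) (Sym n))

EXsq : ℕ → ℚ
EXsq n = ℚ._/_ (sumXsq n) (n !) {{n !≢0}}

-- Write y = 2X = 2L − (D+1)D, so that 64X² = 16y².  Every w ∈ S_(n+1) arises exactly once from some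
-- w′ ∈ S_n by raising all its values by one and inserting 1 at an index t ≤ n; then L increases by t,
-- D increases by [w′⁻¹(1) ≤ t], and the new position of 1 is t + 1.  Averaging these recurrences over t
-- yields exact formulas for the means of L, L², D and D² (the mixed moment of D with the position of 1
-- enters the one for D²):
--   E L = n(n−1)/4,  E L² = (2n(n−1)(2n+5) + 9n²(n−1)²)/144,  E D = (n−1)/2,  E D² = (n+1 + 3(n−1)²)/12.
-- Pointwise, 16y² lies between two polynomials that are linear in L², L, D² and D, so their means are
-- known exactly, and both equal n⁴ + O(n³); in fact 9·|64 E X² − n⁴| ≤ 1200 n³ for n ≥ 2.

module Submission where

open import Defs
open import Data.Bool using (T; true; false; if_then_else_)
open import Data.Empty using (⊥-elim)
open import Data.List using (List; []; _∷_; _++_; _∷ʳ_; map; concatMap; upTo; applyUpTo; length; foldr)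
open import Data.List.Properties
  using (map-∘; map-upTo; length-map; length-upTo; upTo-∷ʳ; concatMap-map; map-concatMap; concatMap-cong)
open import Data.List.Relation.Unary.All as All using (All; []; _∷_)
import Data.List.Relation.Unary.All.Properties as All
open import Data.List.Relation.Unary.Any using (here; there)
open import Data.List.Membership.Propositional using (_∈_)
open import Data.List.Membership.Propositional.Properties using (∈-map⁺)
open import Data.Nat as ℕ using (ℕ; zero; suc; z≤n; s≤s; _<ᵇ_; _≡ᵇ_; _∸_; _!)
import Data.Nat.Properties as ℕ
open import Data.Nat.ListAction using (sum)
open import Data.Nat.Combinatorics using (_C_; nCk+nC[k+1]≡[n+1]C[k+1]; nC1≡n)
open import Data.Integer using (ℤ; +_; -[1+_]; 0ℤ; 1ℤ; _+_; _*_; _-_; -_; _≤_; +≤+; nonNegative; +[1+_]; +<+)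
import Data.Integer.Properties as ℤ
open import Data.Integer.Tactic.RingSolver using (solve-∀)
open import Data.Product using (_,_; ∃-syntax)
open import Function using (_∘_)
open import Relation.Nullary.Reflects using (ofʸ; ofⁿ; det)
open import Relation.Binary.PropositionalEquality hiding ([_])
open ≡-Reasoning
open import Data.Rational as ℚ using (ℚ; mkℚ; 0ℚ; toℚᵘ)
import Data.Rational.Properties as ℚ
open import Data.Rational.Unnormalised as ℚᵘ using (ℚᵘ; mkℚᵘ; *≤*)
import Data.Rational.Unnormalised.Properties as ℚᵘ
open import Data.Sum using (inj₁; inj₂)

cong₃ : {A B C D : Set} (f : A → B → C → D) {a a′ : A} {b b′ : B} {c c′ : C} →
        a ≡ a′ → b ≡ b′ → c ≡ c′ → f a b c ≡ f a′ b′ c′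
cong₃ f refl refl refl = refl

cong₄ : {A B C D E : Set} (f : A → B → C → D → E) {a a′ : A} {b b′ : B} {c c′ : C} {d d′ : D} →
        a ≡ a′ → b ≡ b′ → c ≡ c′ → d ≡ d′ → f a b c d ≡ f a′ b′ c′ d′
cong₄ f refl refl refl refl = refl


-- Defined so that Defs.sumXsq n is literally ∑ (Sym n) (λ w → Xstat n w * Xstat n w).
∑ : {A : Set} → List A → (A → ℤ) → ℤ
∑ xs f = foldr _+_ 0ℤ (map f xs)

module _ {A : Set} where

  ∑-++ : (xs ys : List A) (f : A → ℤ) → ∑ (xs ++ ys) f ≡ ∑ xs f + ∑ ys f
  ∑-++ []       ys f = sym (ℤ.+-identityˡ _)
  ∑-++ (x ∷ xs) ys f = trans (cong (_+_ (f x)) (∑-++ xs ys f)) (sym (ℤ.+-assoc (f x) _ _))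

  ∑-cong : (xs : List A) {f g : A → ℤ} → (∀ x → f x ≡ g x) → ∑ xs f ≡ ∑ xs g
  ∑-cong []       f≡g = refl
  ∑-cong (x ∷ xs) f≡g = cong₂ _+_ (f≡g x) (∑-cong xs f≡g)

  ∑-congᴬ : {P : A → Set} {xs : List A} {f g : A → ℤ} → All P xs → (∀ x → P x → f x ≡ g x) → ∑ xs f ≡ ∑ xs g
  ∑-congᴬ []         f≡g = refl
  ∑-congᴬ (px ∷ pxs) f≡g = cong₂ _+_ (f≡g _ px) (∑-congᴬ pxs f≡g)

  ∑-monoᴬ : {P : A → Set} {xs : List A} {f g : A → ℤ} → All P xs → (∀ x → P x → f x ≤ g x) → ∑ xs f ≤ ∑ xs g
  ∑-monoᴬ []         f≤g = ℤ.≤-refl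
  ∑-monoᴬ (px ∷ pxs) f≤g = ℤ.+-mono-≤ (f≤g _ px) (∑-monoᴬ pxs f≤g)

  ∑-+ : (xs : List A) (f g : A → ℤ) → ∑ xs (λ x → f x + g x) ≡ ∑ xs f + ∑ xs g
  ∑-+ []       f g = refl
  ∑-+ (x ∷ xs) f g = trans (cong (_+_ (f x + g x)) (∑-+ xs f g)) (interchange (f x) (g x) _ _)
    where
    interchange : ∀ a b c d → a + b + (c + d) ≡ a + c + (b + d)
    interchange = solve-∀

  ∑-*ˡ : (xs : List A) (c : ℤ) (f : A → ℤ) → ∑ xs (λ x → c * f x) ≡ c * ∑ xs f
  ∑-*ˡ []       c f = sym (ℤ.*-zeroʳ c)
  ∑-*ˡ (x ∷ xs) c f = trans (cong (_+_ (c * f x)) (∑-*ˡ xs c f)) (sym (ℤ.*-distribˡ-+ c (f x) _))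

  ∑-const : (xs : List A) (c : ℤ) → ∑ xs (λ _ → c) ≡ c * + length xs
  ∑-const []       c = sym (ℤ.*-zeroʳ c)
  ∑-const (x ∷ xs) c = trans (cong (_+_ c) (∑-const xs c)) (distrib c (+ length xs))
    where
    distrib : ∀ c l → c + c * l ≡ c * (1ℤ + l)
    distrib = solve-∀

  ∑-linear₂ : (xs : List A) (a b : ℤ) (f g : A → ℤ) →
              ∑ xs (λ x → a * f x + b * g x) ≡ a * ∑ xs f + b * ∑ xs g
  ∑-linear₂ xs a b f g = trans (∑-+ xs _ _) (cong₂ _+_ (∑-*ˡ xs a f) (∑-*ˡ xs b g))

  ∑-linear₃ : (xs : List A) (a b c : ℤ) (f g h : A → ℤ) →
              ∑ xs (λ x → a * f x + b * g x + c * h x) ≡ a * ∑ xs f + b * ∑ xs g + c * ∑ xs h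
  ∑-linear₃ xs a b c f g h = trans (∑-+ xs _ _) (cong₂ _+_ (∑-linear₂ xs a b f g) (∑-*ˡ xs c h))

  ∑-linear₄ : (xs : List A) (a b c d : ℤ) (f g h i : A → ℤ) →
              ∑ xs (λ x → a * f x + b * g x + c * h x + d * i x)
                ≡ a * ∑ xs f + b * ∑ xs g + c * ∑ xs h + d * ∑ xs i
  ∑-linear₄ xs a b c d f g h i = trans (∑-+ xs _ _) (cong₂ _+_ (∑-linear₃ xs a b c f g h) (∑-*ˡ xs d i))

  ∑-linear₅ : (xs : List A) (a b c d e : ℤ) (f g h i j : A → ℤ) →
              ∑ xs (λ x → a * f x + b * g x + c * h x + d * i x + e * j x)
                ≡ a * ∑ xs f + b * ∑ xs g + c * ∑ xs h + d * ∑ xs i + e * ∑ xs j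
  ∑-linear₅ xs a b c d e f g h i j =
    trans (∑-+ xs _ _) (cong₂ _+_ (∑-linear₄ xs a b c d f g h i) (∑-*ˡ xs e j))

module _ {A B : Set} where

  ∑-map : (g : A → B) (xs : List A) (f : B → ℤ) → ∑ (map g xs) f ≡ ∑ xs (f ∘ g)
  ∑-map g []       f = refl
  ∑-map g (x ∷ xs) f = cong (_+_ (f (g x))) (∑-map g xs f)

  ∑-concatMap : (g : A → List B) (xs : List A) (f : B → ℤ) → ∑ (concatMap g xs) f ≡ ∑ xs (λ x → ∑ (g x) f)
  ∑-concatMap g []       f = refl
  ∑-concatMap g (x ∷ xs) f = trans (∑-++ (g x) (concatMap g xs) f) (cong (_+_ (∑ (g x) f)) (∑-concatMap g xs f))

+sum≡∑ : (xs : List ℕ) → + sum xs ≡ ∑ xs (λ k → + k)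
+sum≡∑ []       = refl
+sum≡∑ (x ∷ xs) = trans (ℤ.pos-+ x (sum xs)) (cong (_+_ (+ x)) (+sum≡∑ xs))

∑-upTo-suc : ∀ n (g : ℕ → ℤ) → ∑ (upTo (suc n)) g ≡ g 0 + ∑ (upTo n) (g ∘ suc)
∑-upTo-suc n g = cong (_+_ (g 0)) (trans (cong (λ xs → ∑ xs g) (sym (map-upTo suc n))) (∑-map suc (upTo n) g))

∑-upTo-∷ʳ : ∀ n (g : ℕ → ℤ) → ∑ (upTo (suc n)) g ≡ ∑ (upTo n) g + g n
∑-upTo-∷ʳ n g = begin
  ∑ (upTo (suc n)) g           ≡⟨ cong (λ xs → ∑ xs g) (sym (upTo-∷ʳ n)) ⟩
  ∑ (upTo n ∷ʳ n) g            ≡⟨ ∑-++ (upTo n) (n ∷ []) g ⟩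
  ∑ (upTo n) g + (g n + 0ℤ)    ≡⟨ cong (_+_ (∑ (upTo n) g)) (ℤ.+-identityʳ (g n)) ⟩
  ∑ (upTo n) g + g n           ∎

∑-upTo-congᴬ : ∀ n {f g : ℕ → ℤ} → (∀ t → t ℕ.< n → f t ≡ g t) → ∑ (upTo n) f ≡ ∑ (upTo n) g
∑-upTo-congᴬ n f≡g = ∑-congᴬ (All.applyUpTo⁺₁ (λ t → t) n (λ t<n → t<n)) f≡g

-- Building S_(n+1) from S_n

insertAt : {A : Set} → ℕ → A → List A → List A
insertAt zero    x ys       = x ∷ ys
insertAt (suc t) x []       = x ∷ []
insertAt (suc t) x (y ∷ ys) = y ∷ insertAt t x ys

module _ {A : Set} where

  length-insertAt : ∀ t (x : A) ys → t ℕ.≤ length ys → length (insertAt t x ys) ≡ suc (length ys)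
  length-insertAt zero    x ys       _         = refl
  length-insertAt (suc t) x (y ∷ ys) (s≤s t≤l) = cong suc (length-insertAt t x ys t≤l)

  All-insertAt : {P : A → Set} → ∀ t x ys → P x → All P ys → All P (insertAt t x ys)
  All-insertAt zero    x ys       px pys        = px ∷ pys
  All-insertAt (suc t) x []       px []         = px ∷ []
  All-insertAt (suc t) x (y ∷ ys) px (py ∷ pys) = py ∷ All-insertAt t x ys px pys

  ∈-insertAt : ∀ t (x : A) ys → x ∈ insertAt t x ys
  ∈-insertAt zero    x ys       = here refl
  ∈-insertAt (suc t) x []       = here refl
  ∈-insertAt (suc t) x (y ∷ ys) = there (∈-insertAt t x ys)

  ∈-insertAt⁺ : ∀ t (x : A) ys {z} → z ∈ ys → z ∈ insertAt t x ys
  ∈-insertAt⁺ zero    x ys       z∈        = there z∈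
  ∈-insertAt⁺ (suc t) x (y ∷ ys) (here z≡) = here z≡
  ∈-insertAt⁺ (suc t) x (y ∷ ys) (there z∈) = there (∈-insertAt⁺ t x ys z∈)

insertAll≡map-insertAt : {A : Set} (x : A) (ys : List A) →
                         insertAll x ys ≡ map (λ t → insertAt t x ys) (upTo (suc (length ys)))
insertAll≡map-insertAt x []       = refl
insertAll≡map-insertAt x (y ∷ ys) = cong ((x ∷ y ∷ ys) ∷_) (begin
  map (y ∷_) (insertAll x ys)
    ≡⟨ cong (map (y ∷_)) (insertAll≡map-insertAt x ys) ⟩
  map (y ∷_) (map (λ t → insertAt t x ys) (upTo (suc (length ys))))
    ≡⟨ sym (map-∘ (upTo (suc (length ys)))) ⟩
  map (λ t → insertAt (suc t) x (y ∷ ys)) (upTo (suc (length ys)))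
    ≡⟨ map-∘ (upTo (suc (length ys))) ⟩
  map (λ t → insertAt t x (y ∷ ys)) (map suc (upTo (suc (length ys))))
    ≡⟨ cong (map (λ t → insertAt t x (y ∷ ys))) (map-upTo suc (suc (length ys))) ⟩
  map (λ t → insertAt t x (y ∷ ys)) (applyUpTo suc (suc (length ys)))
    ∎)

insertAll-map : {A B : Set} (f : A → B) (x : A) (ys : List A) →
                insertAll (f x) (map f ys) ≡ map (map f) (insertAll x ys)
insertAll-map f x []       = refl
insertAll-map f x (y ∷ ys) = cong ((f x ∷ f y ∷ map f ys) ∷_) (begin
  map (f y ∷_) (insertAll (f x) (map f ys))  ≡⟨ cong (map (f y ∷_)) (insertAll-map f x ys) ⟩
  map (f y ∷_) (map (map f) (insertAll x ys)) ≡⟨ sym (map-∘ (insertAll x ys)) ⟩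
  map (λ zs → f y ∷ map f zs) (insertAll x ys) ≡⟨ map-∘ (insertAll x ys) ⟩
  map (map f) (map (y ∷_) (insertAll x ys))  ∎)

perms-map : {A B : Set} (f : A → B) (xs : List A) → perms (map f xs) ≡ map (map f) (perms xs)
perms-map f []       = refl
perms-map f (x ∷ xs) = begin
  concatMap (insertAll (f x)) (perms (map f xs))
    ≡⟨ cong (concatMap (insertAll (f x))) (perms-map f xs) ⟩
  concatMap (insertAll (f x)) (map (map f) (perms xs))
    ≡⟨ concatMap-map (insertAll (f x)) (map f) (perms xs) ⟩
  concatMap (λ w → insertAll (f x) (map f w)) (perms xs)
    ≡⟨ concatMap-cong (insertAll-map f x) (perms xs) ⟩
  concatMap (λ w → map (map f) (insertAll x w)) (perms xs)
    ≡⟨ sym (map-concatMap (map f) (insertAll x) (perms xs)) ⟩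
  map (map f) (concatMap (insertAll x) (perms xs))
    ∎

extend : ℕ → List ℕ → List ℕ
extend t w = insertAt t 1 (map suc w)

extensions : List ℕ → List (List ℕ)
extensions w = map (λ t → extend t w) (upTo (suc (length w)))

Sym-suc : ∀ n → Sym (suc n) ≡ concatMap extensions (Sym n)
Sym-suc n = begin
  perms (1 ∷ map suc (applyUpTo suc n))
    ≡⟨ cong (λ xs → perms (1 ∷ map suc xs)) (sym (map-upTo suc n)) ⟩
  concatMap (insertAll 1) (perms (map suc [ n ]))
    ≡⟨ cong (concatMap (insertAll 1)) (perms-map suc [ n ]) ⟩
  concatMap (insertAll 1) (map (map suc) (Sym n))
    ≡⟨ concatMap-map (insertAll 1) (map suc) (Sym n) ⟩
  concatMap (λ w → insertAll 1 (map suc w)) (Sym n)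
    ≡⟨ concatMap-cong (λ w → trans (insertAll≡map-insertAt 1 (map suc w))
                                   (cong (λ l → map (λ t → extend t w) (upTo (suc l))) (length-map suc w))) (Sym n) ⟩
  concatMap extensions (Sym n)
    ∎

Sym-ind : (P : ℕ → List ℕ → Set) → P 0 [] →
          (∀ n w t → P n w → t ℕ.≤ length w → P (suc n) (extend t w)) →
          ∀ n → All (P n) (Sym n)
Sym-ind P P[] P-extend zero    = P[] ∷ []
Sym-ind P P[] P-extend (suc n) rewrite Sym-suc n =
  All.concat⁺ (All.map⁺ (All.map (λ {w} Pw → All.map⁺ (All.applyUpTo⁺₁ (λ t → t) _
    (λ {t} t<1+len → P-extend n w t Pw (ℕ.≤-pred t<1+len))))
    (Sym-ind P P[] P-extend n)))

∑-Sym-suc : ∀ n (F : List ℕ → ℤ) →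
            ∑ (Sym (suc n)) F ≡ ∑ (Sym n) (λ w → ∑ (upTo (suc (length w))) (λ t → F (extend t w)))
∑-Sym-suc n F = begin
  ∑ (Sym (suc n)) F                 ≡⟨ cong (λ ws → ∑ ws F) (Sym-suc n) ⟩
  ∑ (concatMap extensions (Sym n)) F ≡⟨ ∑-concatMap extensions (Sym n) F ⟩
  ∑ (Sym n) (λ w → ∑ (extensions w) F)
    ≡⟨ ∑-cong (Sym n) (λ w → ∑-map (λ t → extend t w) (upTo (suc (length w))) F) ⟩
  ∑ (Sym n) (λ w → ∑ (upTo (suc (length w))) (λ t → F (extend t w)))
    ∎

-- The new (1-based) position of an entry at position q once 1 is inserted at (0-based) index t.
shift : ℕ → ℕ → ℕ
shift t q = if t <ᵇ q then suc q else q

𝟙[_≤_] : ℕ → ℕ → ℕ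
𝟙[ q ≤ t ] = if t <ᵇ q then 0 else 1

<⇒<ᵇ≡true : ∀ {a b} → a ℕ.< b → (a <ᵇ b) ≡ true
<⇒<ᵇ≡true {a} {b} a<b = det (ℕ.<ᵇ-reflects-< a b) (ofʸ a<b)

≥⇒<ᵇ≡false : ∀ {a b} → b ℕ.≤ a → (a <ᵇ b) ≡ false
≥⇒<ᵇ≡false {a} {b} b≤a = det (ℕ.<ᵇ-reflects-< a b) (ofⁿ (ℕ.≤⇒≯ b≤a))

shift-suc : ∀ t q → shift (suc t) (suc q) ≡ suc (shift t q)
shift-suc t q with t <ᵇ q
... | true  = refl
... | false = refl

shift-<ᵇ : ∀ t a b → (shift t a <ᵇ shift t b) ≡ (a <ᵇ b)
shift-<ᵇ t a b with t <ᵇ a | ℕ.<ᵇ-reflects-< t a | t <ᵇ b | ℕ.<ᵇ-reflects-< t b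
... | true  | _         | true  | _         = refl
... | true  | ofʸ t<a   | false | ofⁿ t≮b   =
  let b≤a = ℕ.≤-trans (ℕ.≮⇒≥ t≮b) (ℕ.<⇒≤ t<a) in
  trans (≥⇒<ᵇ≡false (ℕ.m≤n⇒m≤1+n b≤a)) (sym (≥⇒<ᵇ≡false b≤a))
... | false | ofⁿ t≮a   | true  | ofʸ t<b   =
  let a<b = ℕ.≤-<-trans (ℕ.≮⇒≥ t≮a) t<b in
  trans (<⇒<ᵇ≡true (ℕ.m≤n⇒m≤1+n a<b)) (sym (<⇒<ᵇ≡true a<b))
... | false | _         | false | _         = refl

𝟙-shift : ∀ t q → (if shift t q <ᵇ suc t then 1 else 0) ≡ 𝟙[ q ≤ t ]
𝟙-shift t q with t <ᵇ q | ℕ.<ᵇ-reflects-< t q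
... | true  | ofʸ t<q = cong (λ b → if b then 1 else 0) (≥⇒<ᵇ≡false (ℕ.<⇒≤ t<q))
... | false | ofⁿ t≮q = cong (λ b → if b then 1 else 0) (<⇒<ᵇ≡true (s≤s (ℕ.≮⇒≥ t≮q)))

winv≤length : ∀ w i → winv w i ℕ.≤ length w
winv≤length []       i = z≤n
winv≤length (x ∷ xs) i with x ≡ᵇ i
... | true  = s≤s z≤n
... | false = s≤s (winv≤length xs i)

winv-map-suc : ∀ w j → winv (map suc w) (suc j) ≡ winv w j
winv-map-suc []       j = refl
winv-map-suc (x ∷ xs) j = cong (λ p → if x ≡ᵇ j then 1 else suc p) (winv-map-suc xs j)

winv-extend-1 : ∀ t w → All (1 ℕ.≤_) w → t ℕ.≤ length w → winv (extend t w) 1 ≡ suc t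
winv-extend-1 zero    w            _         _         = refl
winv-extend-1 (suc t) (suc x ∷ xs) (_ ∷ pos) (s≤s t≤l) = cong suc (winv-extend-1 t xs pos t≤l)

winv-extend-suc : ∀ t w k → suc k ∈ w → winv (extend t w) (suc (suc k)) ≡ shift t (winv w (suc k))
winv-extend-suc zero (x ∷ xs) k _ with x ≡ᵇ suc k
... | true  = refl
... | false = cong (suc ∘ suc) (winv-map-suc xs (suc k))
winv-extend-suc (suc t) (x ∷ xs) k k∈ with x ≡ᵇ suc k in x≢
... | true  = refl
... | false = trans (cong suc (winv-extend-suc t xs k (∈-tail k∈)))
                    (sym (shift-suc t (winv xs (suc k))))
  where
  ∈-tail : suc k ∈ x ∷ xs → suc k ∈ xs
  ∈-tail (here k≡x)  = ⊥-elim (subst T x≢ (ℕ.≡⇒≡ᵇ x (suc k) (sym k≡x)))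
  ∈-tail (there k∈) = k∈

∑-upTo-id : ∀ m → + 2 * ∑ (upTo m) (λ t → + t) ≡ + m * (+ m - 1ℤ)
∑-upTo-id zero    = refl
∑-upTo-id (suc m) = begin
  + 2 * ∑ (upTo (suc m)) (λ t → + t)         ≡⟨ cong (+ 2 *_) (∑-upTo-∷ʳ m (λ t → + t)) ⟩
  + 2 * (∑ (upTo m) (λ t → + t) + + m)       ≡⟨ ℤ.*-distribˡ-+ (+ 2) (∑ (upTo m) (λ t → + t)) (+ m) ⟩
  + 2 * ∑ (upTo m) (λ t → + t) + + 2 * + m   ≡⟨ cong (_+ + 2 * + m) (∑-upTo-id m) ⟩
  + m * (+ m - 1ℤ) + + 2 * + m               ≡⟨ step (+ m) ⟩
  (1ℤ + + m) * ((1ℤ + + m) - 1ℤ)             ∎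
  where
  step : ∀ m → m * (m - 1ℤ) + + 2 * m ≡ (1ℤ + m) * ((1ℤ + m) - 1ℤ)
  step = solve-∀

∑-upTo-square : ∀ m → + 6 * ∑ (upTo m) (λ t → + t * + t) ≡ (+ m - 1ℤ) * + m * (+ 2 * + m - 1ℤ)
∑-upTo-square zero    = refl
∑-upTo-square (suc m) = begin
  + 6 * ∑ (upTo (suc m)) (λ t → + t * + t)
    ≡⟨ cong (+ 6 *_) (∑-upTo-∷ʳ m (λ t → + t * + t)) ⟩
  + 6 * (∑ (upTo m) (λ t → + t * + t) + + m * + m)
    ≡⟨ ℤ.*-distribˡ-+ (+ 6) (∑ (upTo m) (λ t → + t * + t)) (+ m * + m) ⟩
  + 6 * ∑ (upTo m) (λ t → + t * + t) + + 6 * (+ m * + m)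
    ≡⟨ cong (_+ + 6 * (+ m * + m)) (∑-upTo-square m) ⟩
  (+ m - 1ℤ) * + m * (+ 2 * + m - 1ℤ) + + 6 * (+ m * + m)
    ≡⟨ step (+ m) ⟩
  ((1ℤ + + m) - 1ℤ) * (1ℤ + + m) * (+ 2 * (1ℤ + + m) - 1ℤ)
    ∎
  where
  step : ∀ m → (m - 1ℤ) * m * (+ 2 * m - 1ℤ) + + 6 * (m * m) ≡ ((1ℤ + m) - 1ℤ) * (1ℤ + m) * (+ 2 * (1ℤ + m) - 1ℤ)
  step = solve-∀

∑-upTo-suc-id : ∀ m → + 2 * ∑ (upTo m) (λ t → + suc t) ≡ + m * (+ m + 1ℤ)
∑-upTo-suc-id m = begin
  + 2 * ∑ (upTo m) (λ t → + suc t)   ≡⟨ cong (+ 2 *_) (sym (trans (∑-upTo-suc m (λ t → + t)) (ℤ.+-identityˡ _))) ⟩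
  + 2 * ∑ (upTo (suc m)) (λ t → + t)           ≡⟨ ∑-upTo-id (suc m) ⟩
  (1ℤ + + m) * ((1ℤ + + m) - 1ℤ)      ≡⟨ step (+ m) ⟩
  + m * (+ m + 1ℤ)                    ∎
  where
  step : ∀ m → (1ℤ + m) * ((1ℤ + m) - 1ℤ) ≡ m * (m + 1ℤ)
  step = solve-∀

∑-upTo-suc-square : ∀ m → + 6 * ∑ (upTo m) (λ t → + suc t * + suc t) ≡ + m * (+ m + 1ℤ) * (+ 2 * + m + 1ℤ)
∑-upTo-suc-square m = begin
  + 6 * ∑ (upTo m) (λ t → + suc t * + suc t)
    ≡⟨ cong (+ 6 *_) (sym (trans (∑-upTo-suc m (λ t → + t * + t)) (ℤ.+-identityˡ _))) ⟩
  + 6 * ∑ (upTo (suc m)) (λ t → + t * + t)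
    ≡⟨ ∑-upTo-square (suc m) ⟩
  ((1ℤ + + m) - 1ℤ) * (1ℤ + + m) * (+ 2 * (1ℤ + + m) - 1ℤ)
    ≡⟨ step (+ m) ⟩
  + m * (+ m + 1ℤ) * (+ 2 * + m + 1ℤ)
    ∎
  where
  step : ∀ m → ((1ℤ + m) - 1ℤ) * (1ℤ + m) * (+ 2 * (1ℤ + m) - 1ℤ) ≡ m * (m + 1ℤ) * (+ 2 * m + 1ℤ)
  step = solve-∀

∑-𝟙[suc≤] : ∀ t n → t ℕ.≤ n → ∑ (upTo n) (λ p → + 𝟙[ suc p ≤ t ]) ≡ + t
∑-𝟙[suc≤] zero    n       _         = ∑-const (upTo n) 0ℤ
∑-𝟙[suc≤] (suc t) (suc n) (s≤s t≤n) =
  trans (∑-upTo-suc n (λ p → + 𝟙[ suc p ≤ suc t ])) (cong (_+_ 1ℤ) (∑-𝟙[suc≤] t n t≤n))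

∑-𝟙[≤] : ∀ m q → q ℕ.≤ m → ∑ (upTo m) (λ t → + 𝟙[ q ≤ t ]) ≡ + m - + q
∑-𝟙[≤] m zero _ = begin
  ∑ (upTo m) (λ _ → 1ℤ)  ≡⟨ ∑-const (upTo m) 1ℤ ⟩
  1ℤ * + length (upTo m) ≡⟨ ℤ.*-identityˡ _ ⟩
  + length (upTo m)      ≡⟨ cong +_ (length-upTo m) ⟩
  + m                    ≡⟨ ℤ.+-identityʳ (+ m) ⟨
  + m - + 0              ∎
∑-𝟙[≤] (suc m) (suc q) (s≤s q≤m) = begin
  ∑ (upTo (suc m)) (λ t → + 𝟙[ suc q ≤ t ])  ≡⟨ ∑-upTo-suc m (λ t → + 𝟙[ suc q ≤ t ]) ⟩
  0ℤ + ∑ (upTo m) (λ t → + 𝟙[ q ≤ t ])      ≡⟨ ℤ.+-identityˡ _ ⟩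
  ∑ (upTo m) (λ t → + 𝟙[ q ≤ t ])           ≡⟨ ∑-𝟙[≤] m q q≤m ⟩
  + m - + q                                  ≡⟨ step (+ m) (+ q) ⟩
  (1ℤ + + m) - (1ℤ + + q)                    ∎
  where
  step : ∀ m q → m - q ≡ (1ℤ + m) - (1ℤ + q)
  step = solve-∀

∑-𝟙[≤]-suc : ∀ m q → q ℕ.≤ m →
             + 2 * ∑ (upTo m) (λ t → + 𝟙[ q ≤ t ] * + suc t) ≡ + m * (+ m + 1ℤ) - + q * (+ q + 1ℤ)
∑-𝟙[≤]-suc m zero _ = begin
  + 2 * ∑ (upTo m) (λ t → 1ℤ * + suc t)  ≡⟨ cong (+ 2 *_) (∑-cong (upTo m) (λ t → ℤ.*-identityˡ (+ suc t))) ⟩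
  + 2 * ∑ (upTo m) (λ t → + suc t)       ≡⟨ ∑-upTo-suc-id m ⟩
  + m * (+ m + 1ℤ)                       ≡⟨ ℤ.+-identityʳ _ ⟨
  + m * (+ m + 1ℤ) - 0ℤ                  ∎
∑-𝟙[≤]-suc (suc m) (suc q) (s≤s q≤m) = begin
  + 2 * ∑ (upTo (suc m)) (λ t → + 𝟙[ suc q ≤ t ] * + suc t)
    ≡⟨ cong (+ 2 *_) (trans (∑-upTo-suc m (λ t → + 𝟙[ suc q ≤ t ] * + suc t)) (ℤ.+-identityˡ _)) ⟩
  + 2 * ∑ (upTo m) (λ t → + 𝟙[ q ≤ t ] * (1ℤ + + suc t))
    ≡⟨ cong (+ 2 *_) (∑-cong (upTo m) (λ t → ℤ.*-distribˡ-+ (+ 𝟙[ q ≤ t ]) 1ℤ (+ suc t))) ⟩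
  + 2 * ∑ (upTo m) (λ t → + 𝟙[ q ≤ t ] * 1ℤ + + 𝟙[ q ≤ t ] * + suc t)
    ≡⟨ cong (+ 2 *_) (∑-+ (upTo m) (λ t → + 𝟙[ q ≤ t ] * 1ℤ) (λ t → + 𝟙[ q ≤ t ] * + suc t)) ⟩
  + 2 * (∑ (upTo m) (λ t → + 𝟙[ q ≤ t ] * 1ℤ) + ∑ (upTo m) (λ t → + 𝟙[ q ≤ t ] * + suc t))
    ≡⟨ ℤ.*-distribˡ-+ (+ 2) (∑ (upTo m) (λ t → + 𝟙[ q ≤ t ] * 1ℤ)) (∑ (upTo m) (λ t → + 𝟙[ q ≤ t ] * + suc t)) ⟩
  + 2 * ∑ (upTo m) (λ t → + 𝟙[ q ≤ t ] * 1ℤ) + + 2 * ∑ (upTo m) (λ t → + 𝟙[ q ≤ t ] * + suc t)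
    ≡⟨ cong₂ (λ a b → + 2 * a + b)
             (trans (∑-cong (upTo m) (λ t → ℤ.*-identityʳ _)) (∑-𝟙[≤] m q q≤m)) (∑-𝟙[≤]-suc m q q≤m) ⟩
  + 2 * (+ m - + q) + (+ m * (+ m + 1ℤ) - + q * (+ q + 1ℤ))
    ≡⟨ step (+ m) (+ q) ⟩
  (1ℤ + + m) * ((1ℤ + + m) + 1ℤ) - (1ℤ + + q) * ((1ℤ + + q) + 1ℤ)
    ∎
  where
  step : ∀ m q → + 2 * (m - q) + (m * (m + 1ℤ) - q * (q + 1ℤ))
               ≡ (1ℤ + m) * ((1ℤ + m) + 1ℤ) - (1ℤ + q) * ((1ℤ + q) + 1ℤ)
  step = solve-∀

∑-shift : ∀ (g : ℕ → ℤ) t n → t ℕ.≤ n →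
          g (suc t) + ∑ (upTo n) (λ p → g (shift t (suc p))) ≡ ∑ (upTo (suc n)) (λ p → g (suc p))
∑-shift g zero    n       _         = sym (∑-upTo-suc n (g ∘ suc))
∑-shift g (suc t) (suc n) (s≤s t≤n) = begin
  g (suc (suc t)) + ∑ (upTo (suc n)) (λ p → g (shift (suc t) (suc p)))
    ≡⟨ cong (_+_ (g (suc (suc t)))) (∑-upTo-suc n (λ p → g (shift (suc t) (suc p)))) ⟩
  g (suc (suc t)) + (g 1 + ∑ (upTo n) (λ p → g (shift (suc t) (suc (suc p)))))
    ≡⟨ cong (λ s → g (suc (suc t)) + (g 1 + s)) (∑-cong (upTo n) (λ p → cong g (shift-suc t (suc p)))) ⟩
  g (suc (suc t)) + (g 1 + ∑ (upTo n) (λ p → g (suc (shift t (suc p)))))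
    ≡⟨ swap (g (suc (suc t))) (g 1) _ ⟩
  g 1 + (g (suc (suc t)) + ∑ (upTo n) (λ p → g (suc (shift t (suc p)))))
    ≡⟨ cong (_+_ (g 1)) (∑-shift (g ∘ suc) t n t≤n) ⟩
  g 1 + ∑ (upTo (suc n)) (λ p → g (suc (suc p)))
    ≡⟨ ∑-upTo-suc (suc n) (g ∘ suc) ⟨
  ∑ (upTo (suc (suc n))) (λ p → g (suc p))
    ∎
  where
  swap : ∀ a b c → a + (b + c) ≡ b + (a + c)
  swap = solve-∀

-- The statistics and their recurrences

L D : ℕ → List ℕ → ℤ
L n w = + Lstat n w
D n w = + Dstat n w

pos₁ : List ℕ → ℤ
pos₁ w = + winv w 1

L≡∑∑X : ∀ n w → L n w ≡ ∑ (upTo n) (λ a → ∑ (upTo a) (λ b → + Xij w (suc b) (suc a)))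
L≡∑∑X n w = begin
  + Lstat n w                              ≡⟨ +sum≡∑ (concatMap row [ n ]) ⟩
  ∑ (concatMap row [ n ]) (λ k → + k)      ≡⟨ ∑-concatMap row [ n ] (λ k → + k) ⟩
  ∑ [ n ] (λ j → ∑ (row j) (λ k → + k))    ≡⟨ ∑-map suc (upTo n) (λ j → ∑ (row j) (λ k → + k)) ⟩
  ∑ (upTo n) (λ a → ∑ (row (suc a)) (λ k → + k))
    ≡⟨ ∑-cong (upTo n) (λ a → trans (∑-map (λ i → Xij w i (suc a)) (map suc (upTo a)) (λ k → + k))
                                    (∑-map suc (upTo a) (λ i → + Xij w i (suc a)))) ⟩
  ∑ (upTo n) (λ a → ∑ (upTo a) (λ b → + Xij w (suc b) (suc a)))
    ∎
  where
  row : ℕ → List ℕ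
  row j = map (λ i → Xij w i j) (map suc (upTo (j ∸ 1)))

D≡∑X : ∀ n w → D n w ≡ ∑ (upTo (n ∸ 1)) (λ a → + Xij w (suc a) (suc (suc a)))
D≡∑X n w = begin
  + Dstat n w                                           ≡⟨ +sum≡∑ (map X[i,i+1] [ n ∸ 1 ]) ⟩
  ∑ (map X[i,i+1] [ n ∸ 1 ]) (λ k → + k)                ≡⟨ ∑-map X[i,i+1] [ n ∸ 1 ] (λ k → + k) ⟩
  ∑ [ n ∸ 1 ] (λ i → + X[i,i+1] i)                       ≡⟨ ∑-map suc (upTo (n ∸ 1)) (λ i → + X[i,i+1] i) ⟩
  ∑ (upTo (n ∸ 1)) (λ a → + Xij w (suc a) (suc (suc a))) ∎
  where
  X[i,i+1] : ℕ → ℕ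
  X[i,i+1] i = Xij w i (suc i)

Xij≤1 : ∀ w i j → Xij w i j ℕ.≤ 1
Xij≤1 w i j with winv w j <ᵇ winv w i
... | true  = s≤s z≤n
... | false = z≤n

sum≤length : ∀ xs → All (ℕ._≤ 1) xs → sum xs ℕ.≤ length xs
sum≤length []       []           = z≤n
sum≤length (x ∷ xs) (x≤1 ∷ xs≤1) = ℕ.+-mono-≤ x≤1 (sum≤length xs xs≤1)

D≤n : ∀ n w → D n w ≤ + n
D≤n n w = +≤+ (ℕ.≤-trans (sum≤length (map X[i,i+1] [ n ∸ 1 ]) (All.map⁺ (All.universal (λ i → Xij≤1 w i (suc i)) _)))
                         (ℕ.≤-trans (ℕ.≤-reflexive length≡n∸1) (ℕ.m∸n≤m n 1)))
  where
  X[i,i+1] : ℕ → ℕ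
  X[i,i+1] i = Xij w i (suc i)
  length≡n∸1 : length (map X[i,i+1] [ n ∸ 1 ]) ≡ n ∸ 1
  length≡n∸1 = trans (length-map X[i,i+1] [ n ∸ 1 ]) (trans (length-map suc (upTo (n ∸ 1))) (length-upTo (n ∸ 1)))

-- The facts about w ∈ S_n that the recurrences use; extend preserves them (SymInvariant-Sym).
record SymInvariant (n : ℕ) (w : List ℕ) : Set where
  field
    length≡  : length w ≡ n
    entries≥1 : All (1 ℕ.≤_) w
    entries∈ : ∀ a → a ℕ.< n → suc a ∈ w
    ∑∘winv   : ∀ (g : ℕ → ℤ) → ∑ (upTo n) (λ a → g (winv w (suc a))) ≡ ∑ (upTo n) (λ a → g (suc a))

module Extension (n : ℕ) (w : List ℕ) (I : SymInvariant n w) (t : ℕ) (t≤n : t ℕ.≤ n) where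
  open SymInvariant I

  v : List ℕ
  v = extend t w

  private
    t≤length : t ℕ.≤ length w
    t≤length = ℕ.≤-trans t≤n (ℕ.≤-reflexive (sym length≡))

    winv-v-1 : winv v 1 ≡ suc t
    winv-v-1 = winv-extend-1 t w entries≥1 t≤length

  pos₁-extend : pos₁ v ≡ + suc t
  pos₁-extend = cong +_ winv-v-1

  X-extend : ∀ a b → a ℕ.< n → b ℕ.< n → Xij v (suc (suc b)) (suc (suc a)) ≡ Xij w (suc b) (suc a)
  X-extend a b a<n b<n
    rewrite winv-extend-suc t w a (entries∈ a a<n) | winv-extend-suc t w b (entries∈ b b<n)
          | shift-<ᵇ t (winv w (suc a)) (winv w (suc b)) = refl

  X-extend-1 : ∀ a → a ℕ.< n → Xij v 1 (suc (suc a)) ≡ 𝟙[ winv w (suc a) ≤ t ]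
  X-extend-1 a a<n rewrite winv-extend-suc t w a (entries∈ a a<n) | winv-v-1 = 𝟙-shift t (winv w (suc a))

  L-extend : L (suc n) v ≡ L n w + + t
  L-extend = begin
    L (suc n) v
      ≡⟨ L≡∑∑X (suc n) v ⟩
    ∑ (upTo (suc n)) (λ a → ∑ (upTo a) (λ b → + Xij v (suc b) (suc a)))
      ≡⟨ trans (∑-upTo-suc n (λ a → ∑ (upTo a) (λ b → + Xij v (suc b) (suc a)))) (ℤ.+-identityˡ _) ⟩
    ∑ (upTo n) (λ a → ∑ (upTo (suc a)) (λ b → + Xij v (suc b) (suc (suc a))))
      ≡⟨ ∑-cong (upTo n) (λ a → ∑-upTo-suc a (λ b → + Xij v (suc b) (suc (suc a)))) ⟩
    ∑ (upTo n) (λ a → + Xij v 1 (suc (suc a)) + ∑ (upTo a) (λ b → + Xij v (suc (suc b)) (suc (suc a))))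
      ≡⟨ ∑-+ (upTo n) (λ a → + Xij v 1 (suc (suc a))) (λ a → ∑ (upTo a) (λ b → + Xij v (suc (suc b)) (suc (suc a)))) ⟩
    ∑ (upTo n) (λ a → + Xij v 1 (suc (suc a))) + ∑ (upTo n) (λ a → ∑ (upTo a) (λ b → + Xij v (suc (suc b)) (suc (suc a))))
      ≡⟨ cong₂ _+_ (∑-upTo-congᴬ n (λ a a<n → cong +_ (X-extend-1 a a<n)))
                   (∑-upTo-congᴬ n (λ a a<n → ∑-upTo-congᴬ a (λ b b<a →
                      cong +_ (X-extend a b a<n (ℕ.<-trans b<a a<n))))) ⟩
    ∑ (upTo n) (λ a → + 𝟙[ winv w (suc a) ≤ t ]) + ∑ (upTo n) (λ a → ∑ (upTo a) (λ b → + Xij w (suc b) (suc a)))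
      ≡⟨ cong₂ _+_ (trans (∑∘winv (λ q → + 𝟙[ q ≤ t ])) (∑-𝟙[suc≤] t n t≤n)) (sym (L≡∑∑X n w)) ⟩
    + t + L n w
      ≡⟨ ℤ.+-comm (+ t) (L n w) ⟩
    L n w + + t
      ∎

  D-extend : ∀ {m} → n ≡ suc m → D (suc n) v ≡ D n w + + 𝟙[ winv w 1 ≤ t ]
  D-extend {m} refl = begin
    D (suc (suc m)) v
      ≡⟨ D≡∑X (suc (suc m)) v ⟩
    ∑ (upTo (suc m)) (λ a → + Xij v (suc a) (suc (suc a)))
      ≡⟨ ∑-upTo-suc m (λ a → + Xij v (suc a) (suc (suc a))) ⟩
    + Xij v 1 2 + ∑ (upTo m) (λ a → + Xij v (suc (suc a)) (suc (suc (suc a))))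
      ≡⟨ cong₂ _+_ (cong +_ (X-extend-1 0 (s≤s z≤n)))
                   (∑-upTo-congᴬ m (λ a a<m → cong +_ (X-extend (suc a) a (s≤s a<m) (ℕ.m≤n⇒m≤1+n a<m)))) ⟩
    + 𝟙[ winv w 1 ≤ t ] + ∑ (upTo m) (λ a → + Xij w (suc a) (suc (suc a)))
      ≡⟨ cong (_+_ (+ 𝟙[ winv w 1 ≤ t ])) (sym (D≡∑X (suc m) w)) ⟩
    + 𝟙[ winv w 1 ≤ t ] + D (suc m) w
      ≡⟨ ℤ.+-comm (+ 𝟙[ winv w 1 ≤ t ]) (D (suc m) w) ⟩
    D (suc m) w + + 𝟙[ winv w 1 ≤ t ]
      ∎

  ∑∘winv-extend : ∀ (g : ℕ → ℤ) → ∑ (upTo (suc n)) (λ a → g (winv v (suc a))) ≡ ∑ (upTo (suc n)) (λ a → g (suc a))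
  ∑∘winv-extend g = begin
    ∑ (upTo (suc n)) (λ a → g (winv v (suc a)))
      ≡⟨ ∑-upTo-suc n (λ a → g (winv v (suc a))) ⟩
    g (winv v 1) + ∑ (upTo n) (λ a → g (winv v (suc (suc a))))
      ≡⟨ cong₂ _+_ (cong g winv-v-1) (∑-upTo-congᴬ n (λ a a<n → cong g (winv-extend-suc t w a (entries∈ a a<n)))) ⟩
    g (suc t) + ∑ (upTo n) (λ a → g (shift t (winv w (suc a))))
      ≡⟨ cong (_+_ (g (suc t))) (∑∘winv (g ∘ shift t)) ⟩
    g (suc t) + ∑ (upTo n) (λ a → g (shift t (suc a)))
      ≡⟨ ∑-shift g t n t≤n ⟩
    ∑ (upTo (suc n)) (λ a → g (suc a))
      ∎

  SymInvariant-extend : SymInvariant (suc n) v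
  SymInvariant-extend = record
    { length≡   = trans (length-insertAt t 1 (map suc w) (ℕ.≤-trans t≤length (ℕ.≤-reflexive (sym (length-map suc w)))))
                        (cong suc (trans (length-map suc w) length≡))
    ; entries≥1 = All-insertAt t 1 (map suc w) (s≤s z≤n) (All.map⁺ (All.universal (λ _ → s≤s z≤n) w))
    ; entries∈  = entries∈-extend
    ; ∑∘winv    = ∑∘winv-extend
    }
    where
    entries∈-extend : ∀ a → a ℕ.< suc n → suc a ∈ v
    entries∈-extend zero    _         = ∈-insertAt t 1 (map suc w)
    entries∈-extend (suc a) (s≤s a<n) = ∈-insertAt⁺ t 1 (map suc w) (∈-map⁺ suc (entries∈ a a<n))

SymInvariant-Sym : ∀ n → All (SymInvariant n) (Sym n)
SymInvariant-Sym = Sym-ind SymInvariant invariant[] λ n w t I t≤len →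
  Extension.SymInvariant-extend n w I t (ℕ.≤-trans t≤len (ℕ.≤-reflexive (SymInvariant.length≡ I)))
  where
  invariant[] : SymInvariant 0 []
  invariant[] = record { length≡ = refl ; entries≥1 = [] ; entries∈ = λ _ () ; ∑∘winv = λ _ → refl }

-- Moments over S_n

∑ext : ℕ → List ℕ → (List ℕ → ℤ) → ℤ
∑ext n w F = ∑ (upTo (suc n)) (λ t → F (extend t w))

∑ext-cong : ∀ n w (F : List ℕ → ℤ) {g : ℕ → ℤ} → (∀ t → t ℕ.≤ n → F (extend t w) ≡ g t) →
            ∑ext n w F ≡ ∑ (upTo (suc n)) g
∑ext-cong n w F F≡g = ∑-upTo-congᴬ (suc n) (λ t t<1+n → F≡g t (ℕ.≤-pred t<1+n))

∑-Sym-suc-by : ∀ n (k : ℤ) (F G : List ℕ → ℤ) → (∀ w → SymInvariant n w → k * ∑ext n w F ≡ G w) →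
               k * ∑ (Sym (suc n)) F ≡ ∑ (Sym n) G
∑-Sym-suc-by n k F G kF≡G = begin
  k * ∑ (Sym (suc n)) F
    ≡⟨ cong (k *_) (∑-Sym-suc n F) ⟩
  k * ∑ (Sym n) (λ w → ∑ (upTo (suc (length w))) (λ t → F (extend t w)))
    ≡⟨ ∑-*ˡ (Sym n) k (λ w → ∑ (upTo (suc (length w))) (λ t → F (extend t w))) ⟨
  ∑ (Sym n) (λ w → k * ∑ (upTo (suc (length w))) (λ t → F (extend t w)))
    ≡⟨ ∑-congᴬ (SymInvariant-Sym n) (λ w I →
         trans (cong (λ l → k * ∑ (upTo (suc l)) (λ t → F (extend t w))) (SymInvariant.length≡ I)) (kF≡G w I)) ⟩
  ∑ (Sym n) G
    ∎

∑-upTo-const : ∀ m c → ∑ (upTo m) (λ _ → c) ≡ c * + m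
∑-upTo-const m c = trans (∑-const (upTo m) c) (cong (λ l → c * + l) (length-upTo m))

+!-suc : ∀ n → + (suc n !) ≡ + suc n * + (n !)
+!-suc n = ℤ.pos-* (suc n) (n !)

∑-Sym-1 : ∀ n → ∑ (Sym n) (λ _ → 1ℤ) ≡ + (n !)
∑-Sym-1 zero    = refl
∑-Sym-1 (suc n) = begin
  ∑ (Sym (suc n)) (λ _ → 1ℤ)         ≡⟨ ℤ.*-identityˡ _ ⟨
  1ℤ * ∑ (Sym (suc n)) (λ _ → 1ℤ)    ≡⟨ ∑-Sym-suc-by n 1ℤ (λ _ → 1ℤ) (λ _ → + suc n * 1ℤ) (λ w _ →
                                          trans (ℤ.*-identityˡ _) (trans (∑-upTo-const (suc n) 1ℤ) (ℤ.*-comm 1ℤ (+ suc n)))) ⟩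
  ∑ (Sym n) (λ _ → + suc n * 1ℤ)     ≡⟨ ∑-*ˡ (Sym n) (+ suc n) (λ _ → 1ℤ) ⟩
  + suc n * ∑ (Sym n) (λ _ → 1ℤ)     ≡⟨ cong (+ suc n *_) (∑-Sym-1 n) ⟩
  + suc n * + (n !)                  ≡⟨ +!-suc n ⟨
  + (suc n !)                        ∎

ΣL ΣL² ΣD ΣD² ΣDP ΣP ΣP² : ℕ → ℤ
ΣL  n = ∑ (Sym n) (L n)
ΣL² n = ∑ (Sym n) (λ w → L n w * L n w)
ΣD  n = ∑ (Sym n) (D n)
ΣD² n = ∑ (Sym n) (λ w → D n w * D n w)
ΣDP n = ∑ (Sym n) (λ w → D n w * pos₁ w)
ΣP  n = ∑ (Sym n) pos₁
ΣP² n = ∑ (Sym n) (λ w → pos₁ w * pos₁ w)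

∑ext-L : ∀ n w → SymInvariant n w →
         + 2 * ∑ext n w (L (suc n)) ≡ (+ 2 * + suc n) * L n w + (+ suc n * (+ suc n - 1ℤ)) * 1ℤ
∑ext-L n w I = begin
  + 2 * ∑ext n w (L (suc n))
    ≡⟨ cong (+ 2 *_) (∑ext-cong n w (L (suc n)) (Extension.L-extend n w I)) ⟩
  + 2 * ∑ (upTo (suc n)) (λ t → L n w + + t)
    ≡⟨ cong (+ 2 *_) (∑-+ (upTo (suc n)) (λ _ → L n w) (λ t → + t)) ⟩
  + 2 * (∑ (upTo (suc n)) (λ _ → L n w) + ∑ (upTo (suc n)) (λ t → + t))
    ≡⟨ cong (λ s → + 2 * (s + ∑ (upTo (suc n)) (λ t → + t))) (∑-upTo-const (suc n) (L n w)) ⟩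
  + 2 * (L n w * + suc n + ∑ (upTo (suc n)) (λ t → + t))
    ≡⟨ expand (L n w) (+ suc n) (∑ (upTo (suc n)) (λ t → + t)) ⟩
  (+ 2 * + suc n) * L n w + + 2 * ∑ (upTo (suc n)) (λ t → + t)
    ≡⟨ cong (_+_ ((+ 2 * + suc n) * L n w)) (trans (∑-upTo-id (suc n)) (sym (ℤ.*-identityʳ _))) ⟩
  (+ 2 * + suc n) * L n w + (+ suc n * (+ suc n - 1ℤ)) * 1ℤ
    ∎
  where
  expand : ∀ l m s → + 2 * (l * m + s) ≡ (+ 2 * m) * l + + 2 * s
  expand = solve-∀

ΣL-formula : ∀ n → + 4 * ΣL n ≡ + n * (+ n - 1ℤ) * + (n !)
ΣL-formula zero    = refl
ΣL-formula (suc n) = begin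
  + 4 * ΣL (suc n)
    ≡⟨ ℤ.*-assoc (+ 2) (+ 2) (ΣL (suc n)) ⟩
  + 2 * (+ 2 * ΣL (suc n))
    ≡⟨ cong (+ 2 *_) (∑-Sym-suc-by n (+ 2) (L (suc n)) _ (∑ext-L n)) ⟩
  + 2 * ∑ (Sym n) (λ w → (+ 2 * M) * L n w + (M * (M - 1ℤ)) * 1ℤ)
    ≡⟨ cong (+ 2 *_) (∑-linear₂ (Sym n) (+ 2 * M) (M * (M - 1ℤ)) (L n) (λ _ → 1ℤ)) ⟩
  + 2 * ((+ 2 * M) * ΣL n + (M * (M - 1ℤ)) * ∑ (Sym n) (λ _ → 1ℤ))
    ≡⟨ cong (λ f → + 2 * ((+ 2 * M) * ΣL n + (M * (M - 1ℤ)) * f)) (∑-Sym-1 n) ⟩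
  + 2 * ((+ 2 * M) * ΣL n + (M * (M - 1ℤ)) * F)
    ≡⟨ regroup (+ n) (ΣL n) F ⟩
  M * (+ 4 * ΣL n) + + 2 * M * + n * F
    ≡⟨ cong (λ s → M * s + + 2 * M * + n * F) (ΣL-formula n) ⟩
  M * (+ n * (+ n - 1ℤ) * F) + + 2 * M * + n * F
    ≡⟨ collect (+ n) F ⟩
  M * (M - 1ℤ) * (M * F)
    ≡⟨ cong (M * (M - 1ℤ) *_) (+!-suc n) ⟨
  M * (M - 1ℤ) * + (suc n !)
    ∎
  where
  M F : ℤ
  M = + suc n
  F = + (n !)
  regroup : ∀ n s f → + 2 * ((+ 2 * (1ℤ + n)) * s + ((1ℤ + n) * ((1ℤ + n) - 1ℤ)) * f)
                    ≡ (1ℤ + n) * (+ 4 * s) + + 2 * (1ℤ + n) * n * f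
  regroup = solve-∀
  collect : ∀ n f → (1ℤ + n) * (n * (n - 1ℤ) * f) + + 2 * (1ℤ + n) * n * f ≡ (1ℤ + n) * ((1ℤ + n) - 1ℤ) * ((1ℤ + n) * f)
  collect = solve-∀

∑ext-L² : ∀ n w → SymInvariant n w →
          + 6 * ∑ext n w (λ v → L (suc n) v * L (suc n) v)
            ≡ (+ 6 * + suc n) * (L n w * L n w) + (+ 6 * + suc n * (+ suc n - 1ℤ)) * L n w
              + ((+ suc n - 1ℤ) * + suc n * (+ 2 * + suc n - 1ℤ)) * 1ℤ
∑ext-L² n w I = begin
  + 6 * ∑ext n w (λ v → L (suc n) v * L (suc n) v)
    ≡⟨ cong (+ 6 *_) (∑ext-cong n w (λ v → L (suc n) v * L (suc n) v) (λ t t≤n →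
         trans (cong (λ l → l * l) (Extension.L-extend n w I t t≤n)) (square-+ l (+ t)))) ⟩
  + 6 * ∑ (upTo (suc n)) (λ t → (l * l) * 1ℤ + (+ 2 * l) * + t + 1ℤ * (+ t * + t))
    ≡⟨ cong (+ 6 *_) (∑-linear₃ (upTo (suc n)) (l * l) (+ 2 * l) 1ℤ (λ _ → 1ℤ) (λ t → + t) (λ t → + t * + t)) ⟩
  + 6 * ((l * l) * ∑ (upTo (suc n)) (λ _ → 1ℤ) + (+ 2 * l) * S₁ + 1ℤ * S₂)
    ≡⟨ cong (λ s → + 6 * ((l * l) * s + (+ 2 * l) * S₁ + 1ℤ * S₂)) (∑-upTo-const (suc n) 1ℤ) ⟩
  + 6 * ((l * l) * (1ℤ * M) + (+ 2 * l) * S₁ + 1ℤ * S₂)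
    ≡⟨ regroup l M S₁ S₂ ⟩
  (+ 6 * M) * (l * l) + + 6 * l * (+ 2 * S₁) + + 6 * S₂
    ≡⟨ cong₂ (λ a b → (+ 6 * M) * (l * l) + + 6 * l * a + b) (∑-upTo-id (suc n)) (∑-upTo-square (suc n)) ⟩
  (+ 6 * M) * (l * l) + + 6 * l * (M * (M - 1ℤ)) + (M - 1ℤ) * M * (+ 2 * M - 1ℤ)
    ≡⟨ collect l M ⟩
  (+ 6 * M) * (l * l) + (+ 6 * M * (M - 1ℤ)) * l + ((M - 1ℤ) * M * (+ 2 * M - 1ℤ)) * 1ℤ
    ∎
  where
  l M S₁ S₂ : ℤ
  l  = L n w
  M  = + suc n
  S₁ = ∑ (upTo (suc n)) (λ t → + t)
  S₂ = ∑ (upTo (suc n)) (λ t → + t * + t)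
  square-+ : ∀ l t → (l + t) * (l + t) ≡ (l * l) * 1ℤ + (+ 2 * l) * t + 1ℤ * (t * t)
  square-+ = solve-∀
  regroup : ∀ l m s₁ s₂ → + 6 * ((l * l) * (1ℤ * m) + (+ 2 * l) * s₁ + 1ℤ * s₂)
                        ≡ (+ 6 * m) * (l * l) + + 6 * l * (+ 2 * s₁) + + 6 * s₂
  regroup = solve-∀
  collect : ∀ l m → (+ 6 * m) * (l * l) + + 6 * l * (m * (m - 1ℤ)) + (m - 1ℤ) * m * (+ 2 * m - 1ℤ)
                  ≡ (+ 6 * m) * (l * l) + (+ 6 * m * (m - 1ℤ)) * l + ((m - 1ℤ) * m * (+ 2 * m - 1ℤ)) * 1ℤ
  collect = solve-∀

ΣL²-formula : ∀ n → let N = + n in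
              + 144 * ΣL² n ≡ (+ 2 * N * (N - 1ℤ) * (+ 2 * N + + 5) + + 9 * (N * N) * ((N - 1ℤ) * (N - 1ℤ))) * + (n !)
ΣL²-formula zero    = refl
ΣL²-formula (suc n) = begin
  + 144 * ΣL² (suc n)
    ≡⟨ ℤ.*-assoc (+ 24) (+ 6) (ΣL² (suc n)) ⟩
  + 24 * (+ 6 * ΣL² (suc n))
    ≡⟨ cong (+ 24 *_) (∑-Sym-suc-by n (+ 6) (λ v → L (suc n) v * L (suc n) v) _ (∑ext-L² n)) ⟩
  + 24 * ∑ (Sym n) (λ w → (+ 6 * M) * (L n w * L n w) + (+ 6 * M * (M - 1ℤ)) * L n w + ((M - 1ℤ) * M * (+ 2 * M - 1ℤ)) * 1ℤ)
    ≡⟨ cong (+ 24 *_) (∑-linear₃ (Sym n) (+ 6 * M) (+ 6 * M * (M - 1ℤ)) ((M - 1ℤ) * M * (+ 2 * M - 1ℤ))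
                                 (λ w → L n w * L n w) (L n) (λ _ → 1ℤ)) ⟩
  + 24 * ((+ 6 * M) * ΣL² n + (+ 6 * M * (M - 1ℤ)) * ΣL n + ((M - 1ℤ) * M * (+ 2 * M - 1ℤ)) * ∑ (Sym n) (λ _ → 1ℤ))
    ≡⟨ cong (λ f → + 24 * ((+ 6 * M) * ΣL² n + (+ 6 * M * (M - 1ℤ)) * ΣL n + ((M - 1ℤ) * M * (+ 2 * M - 1ℤ)) * f))
            (∑-Sym-1 n) ⟩
  + 24 * ((+ 6 * M) * ΣL² n + (+ 6 * M * (M - 1ℤ)) * ΣL n + ((M - 1ℤ) * M * (+ 2 * M - 1ℤ)) * F)
    ≡⟨ regroup (+ n) (ΣL² n) (ΣL n) F ⟩
  M * (+ 144 * ΣL² n) + + 36 * M * + n * (+ 4 * ΣL n) + + 24 * + n * M * (+ 2 * M - 1ℤ) * F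
    ≡⟨ cong₂ (λ a b → M * a + + 36 * M * + n * b + + 24 * + n * M * (+ 2 * M - 1ℤ) * F) (ΣL²-formula n) (ΣL-formula n) ⟩
  M * (p (+ n) * F) + + 36 * M * + n * (+ n * (+ n - 1ℤ) * F) + + 24 * + n * M * (+ 2 * M - 1ℤ) * F
    ≡⟨ collect (+ n) F ⟩
  p M * (M * F)
    ≡⟨ cong (p M *_) (+!-suc n) ⟨
  p M * + (suc n !)
    ∎
  where
  p : ℤ → ℤ
  p N = + 2 * N * (N - 1ℤ) * (+ 2 * N + + 5) + + 9 * (N * N) * ((N - 1ℤ) * (N - 1ℤ))
  M F : ℤ
  M = + suc n
  F = + (n !)
  regroup : ∀ n a b f → + 24 * ((+ 6 * (1ℤ + n)) * a + (+ 6 * (1ℤ + n) * ((1ℤ + n) - 1ℤ)) * b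
                                 + (((1ℤ + n) - 1ℤ) * (1ℤ + n) * (+ 2 * (1ℤ + n) - 1ℤ)) * f)
                      ≡ (1ℤ + n) * (+ 144 * a) + + 36 * (1ℤ + n) * n * (+ 4 * b) + + 24 * n * (1ℤ + n) * (+ 2 * (1ℤ + n) - 1ℤ) * f
  regroup = solve-∀
  collect : ∀ n f → (1ℤ + n) * ((+ 2 * n * (n - 1ℤ) * (+ 2 * n + + 5) + + 9 * (n * n) * ((n - 1ℤ) * (n - 1ℤ))) * f)
                    + + 36 * (1ℤ + n) * n * (n * (n - 1ℤ) * f) + + 24 * n * (1ℤ + n) * (+ 2 * (1ℤ + n) - 1ℤ) * f
                  ≡ (+ 2 * (1ℤ + n) * ((1ℤ + n) - 1ℤ) * (+ 2 * (1ℤ + n) + + 5)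
                     + + 9 * ((1ℤ + n) * (1ℤ + n)) * (((1ℤ + n) - 1ℤ) * ((1ℤ + n) - 1ℤ))) * ((1ℤ + n) * f)
  collect = solve-∀

∑ext-P : ∀ n w → SymInvariant n w → + 2 * ∑ext n w pos₁ ≡ (+ suc n * (+ suc n + 1ℤ)) * 1ℤ
∑ext-P n w I = begin
  + 2 * ∑ext n w pos₁                 ≡⟨ cong (+ 2 *_) (∑ext-cong n w pos₁ (Extension.pos₁-extend n w I)) ⟩
  + 2 * ∑ (upTo (suc n)) (λ t → + suc t) ≡⟨ ∑-upTo-suc-id (suc n) ⟩
  + suc n * (+ suc n + 1ℤ)            ≡⟨ ℤ.*-identityʳ _ ⟨
  (+ suc n * (+ suc n + 1ℤ)) * 1ℤ     ∎

∑ext-P² : ∀ n w → SymInvariant n w →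
          + 6 * ∑ext n w (λ v → pos₁ v * pos₁ v) ≡ (+ suc n * (+ suc n + 1ℤ) * (+ 2 * + suc n + 1ℤ)) * 1ℤ
∑ext-P² n w I = begin
  + 6 * ∑ext n w (λ v → pos₁ v * pos₁ v)
    ≡⟨ cong (+ 6 *_) (∑ext-cong n w (λ v → pos₁ v * pos₁ v) (λ t t≤n → cong (λ p → p * p) (Extension.pos₁-extend n w I t t≤n))) ⟩
  + 6 * ∑ (upTo (suc n)) (λ t → + suc t * + suc t)
    ≡⟨ ∑-upTo-suc-square (suc n) ⟩
  + suc n * (+ suc n + 1ℤ) * (+ 2 * + suc n + 1ℤ)
    ≡⟨ ℤ.*-identityʳ _ ⟨
  (+ suc n * (+ suc n + 1ℤ) * (+ 2 * + suc n + 1ℤ)) * 1ℤ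
    ∎

ΣP-formula : ∀ n → + 2 * ΣP (suc n) ≡ (+ suc n + 1ℤ) * + (suc n !)
ΣP-formula n = begin
  + 2 * ΣP (suc n)                           ≡⟨ ∑-Sym-suc-by n (+ 2) pos₁ _ (∑ext-P n) ⟩
  ∑ (Sym n) (λ _ → (M * (M + 1ℤ)) * 1ℤ)      ≡⟨ ∑-*ˡ (Sym n) (M * (M + 1ℤ)) (λ _ → 1ℤ) ⟩
  (M * (M + 1ℤ)) * ∑ (Sym n) (λ _ → 1ℤ)      ≡⟨ cong ((M * (M + 1ℤ)) *_) (∑-Sym-1 n) ⟩
  (M * (M + 1ℤ)) * + (n !)                   ≡⟨ regroup M (+ (n !)) ⟩
  (M + 1ℤ) * (M * + (n !))                   ≡⟨ cong ((M + 1ℤ) *_) (+!-suc n) ⟨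
  (M + 1ℤ) * + (suc n !)                     ∎
  where
  M : ℤ
  M = + suc n
  regroup : ∀ m f → (m * (m + 1ℤ)) * f ≡ (m + 1ℤ) * (m * f)
  regroup = solve-∀

ΣP²-formula : ∀ n → + 6 * ΣP² (suc n) ≡ (+ suc n + 1ℤ) * (+ 2 * + suc n + 1ℤ) * + (suc n !)
ΣP²-formula n = begin
  + 6 * ΣP² (suc n)
    ≡⟨ ∑-Sym-suc-by n (+ 6) (λ v → pos₁ v * pos₁ v) _ (∑ext-P² n) ⟩
  ∑ (Sym n) (λ _ → (M * (M + 1ℤ) * (+ 2 * M + 1ℤ)) * 1ℤ)
    ≡⟨ ∑-*ˡ (Sym n) (M * (M + 1ℤ) * (+ 2 * M + 1ℤ)) (λ _ → 1ℤ) ⟩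
  (M * (M + 1ℤ) * (+ 2 * M + 1ℤ)) * ∑ (Sym n) (λ _ → 1ℤ)
    ≡⟨ cong ((M * (M + 1ℤ) * (+ 2 * M + 1ℤ)) *_) (∑-Sym-1 n) ⟩
  (M * (M + 1ℤ) * (+ 2 * M + 1ℤ)) * + (n !)
    ≡⟨ regroup M (+ (n !)) ⟩
  (M + 1ℤ) * (+ 2 * M + 1ℤ) * (M * + (n !))
    ≡⟨ cong ((M + 1ℤ) * (+ 2 * M + 1ℤ) *_) (+!-suc n) ⟨
  (M + 1ℤ) * (+ 2 * M + 1ℤ) * + (suc n !)
    ∎
  where
  M : ℤ
  M = + suc n
  regroup : ∀ m f → (m * (m + 1ℤ) * (+ 2 * m + 1ℤ)) * f ≡ (m + 1ℤ) * (+ 2 * m + 1ℤ) * (m * f)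
  regroup = solve-∀

winv-1≤1+n : ∀ n w → SymInvariant n w → winv w 1 ℕ.≤ suc n
winv-1≤1+n n w I = ℕ.m≤n⇒m≤1+n (ℕ.≤-trans (winv≤length w 1) (ℕ.≤-reflexive (SymInvariant.length≡ I)))

∑ext-D : ∀ m w → SymInvariant (suc m) w →
         ∑ext (suc m) w (D (suc (suc m))) ≡ + suc (suc m) * D (suc m) w + + suc (suc m) * 1ℤ + (- 1ℤ) * pos₁ w
∑ext-D m w I = begin
  ∑ext (suc m) w (D (suc (suc m)))
    ≡⟨ ∑ext-cong (suc m) w (D (suc (suc m))) (λ t t≤n → Extension.D-extend (suc m) w I t t≤n refl) ⟩
  ∑ (upTo (suc (suc m))) (λ t → d + + 𝟙[ winv w 1 ≤ t ])
    ≡⟨ ∑-+ (upTo (suc (suc m))) (λ _ → d) (λ t → + 𝟙[ winv w 1 ≤ t ]) ⟩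
  ∑ (upTo (suc (suc m))) (λ _ → d) + ∑ (upTo (suc (suc m))) (λ t → + 𝟙[ winv w 1 ≤ t ])
    ≡⟨ cong₂ _+_ (∑-upTo-const (suc (suc m)) d) (∑-𝟙[≤] (suc (suc m)) (winv w 1) (winv-1≤1+n (suc m) w I)) ⟩
  d * M + (M - pos₁ w)
    ≡⟨ regroup d M (pos₁ w) ⟩
  M * d + M * 1ℤ + (- 1ℤ) * pos₁ w
    ∎
  where
  d M : ℤ
  d = D (suc m) w
  M = + suc (suc m)
  regroup : ∀ d m p → d * m + (m - p) ≡ m * d + m * 1ℤ + (- 1ℤ) * p
  regroup = solve-∀

ΣD-formula : ∀ m → + 2 * ΣD (suc m) ≡ + m * + (suc m !)
ΣD-formula zero    = refl
ΣD-formula (suc m) = begin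
  + 2 * ΣD (suc (suc m))
    ≡⟨ cong (+ 2 *_) (ℤ.*-identityˡ _) ⟨
  + 2 * (1ℤ * ΣD (suc (suc m)))
    ≡⟨ cong (+ 2 *_) (∑-Sym-suc-by (suc m) 1ℤ (D (suc (suc m))) _ (λ w I → trans (ℤ.*-identityˡ _) (∑ext-D m w I))) ⟩
  + 2 * ∑ (Sym (suc m)) (λ w → M * D (suc m) w + M * 1ℤ + (- 1ℤ) * pos₁ w)
    ≡⟨ cong (+ 2 *_) (∑-linear₃ (Sym (suc m)) M M (- 1ℤ) (D (suc m)) (λ _ → 1ℤ) pos₁) ⟩
  + 2 * (M * ΣD (suc m) + M * ∑ (Sym (suc m)) (λ _ → 1ℤ) + (- 1ℤ) * ΣP (suc m))
    ≡⟨ cong (λ f → + 2 * (M * ΣD (suc m) + M * f + (- 1ℤ) * ΣP (suc m))) (∑-Sym-1 (suc m)) ⟩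
  + 2 * (M * ΣD (suc m) + M * F + (- 1ℤ) * ΣP (suc m))
    ≡⟨ regroup M (ΣD (suc m)) F (ΣP (suc m)) ⟩
  M * (+ 2 * ΣD (suc m)) + + 2 * M * F - + 2 * ΣP (suc m)
    ≡⟨ cong₂ (λ a b → M * a + + 2 * M * F - b) (ΣD-formula m) (ΣP-formula m) ⟩
  M * (+ m * F) + + 2 * M * F - (+ suc m + 1ℤ) * F
    ≡⟨ collect (+ m) F ⟩
  + suc m * (M * F)
    ≡⟨ cong (+ suc m *_) (+!-suc (suc m)) ⟨
  + suc m * + (suc (suc m) !)
    ∎
  where
  M F : ℤ
  M = + suc (suc m)
  F = + (suc m !)
  regroup : ∀ M s f p → + 2 * (M * s + M * f + (- 1ℤ) * p) ≡ M * (+ 2 * s) + + 2 * M * f - + 2 * p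
  regroup = solve-∀
  collect : ∀ m f → (1ℤ + (1ℤ + m)) * (m * f) + + 2 * (1ℤ + (1ℤ + m)) * f - ((1ℤ + m) + 1ℤ) * f
                  ≡ (1ℤ + m) * ((1ℤ + (1ℤ + m)) * f)
  collect = solve-∀

∑ext-DP : ∀ m w → SymInvariant (suc m) w → let M = + suc (suc m) in
          + 2 * ∑ext (suc m) w (λ v → D (suc (suc m)) v * pos₁ v)
            ≡ (M * (M + 1ℤ)) * D (suc m) w + (M * (M + 1ℤ)) * 1ℤ + (- 1ℤ) * (pos₁ w * pos₁ w) + (- 1ℤ) * pos₁ w
∑ext-DP m w I = begin
  + 2 * ∑ext (suc m) w (λ v → D (suc (suc m)) v * pos₁ v)
    ≡⟨ cong (+ 2 *_) (∑ext-cong (suc m) w (λ v → D (suc (suc m)) v * pos₁ v) (λ t t≤n →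
         trans (cong₂ _*_ (Extension.D-extend (suc m) w I t t≤n refl) (Extension.pos₁-extend (suc m) w I t t≤n))
               (ℤ.*-distribʳ-+ (+ suc t) d (+ 𝟙[ p ≤ t ])))) ⟩
  + 2 * ∑ (upTo (suc (suc m))) (λ t → d * + suc t + + 𝟙[ p ≤ t ] * + suc t)
    ≡⟨ cong (+ 2 *_) (∑-+ (upTo (suc (suc m))) (λ t → d * + suc t) (λ t → + 𝟙[ p ≤ t ] * + suc t)) ⟩
  + 2 * (∑ (upTo (suc (suc m))) (λ t → d * + suc t) + S)
    ≡⟨ cong (λ s → + 2 * (s + S)) (∑-*ˡ (upTo (suc (suc m))) d (λ t → + suc t)) ⟩
  + 2 * (d * ∑ (upTo (suc (suc m))) (λ t → + suc t) + S)
    ≡⟨ regroup d (∑ (upTo (suc (suc m))) (λ t → + suc t)) S ⟩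
  d * (+ 2 * ∑ (upTo (suc (suc m))) (λ t → + suc t)) + + 2 * S
    ≡⟨ cong₂ (λ a b → d * a + b) (∑-upTo-suc-id (suc (suc m))) (∑-𝟙[≤]-suc (suc (suc m)) p (winv-1≤1+n (suc m) w I)) ⟩
  d * (M * (M + 1ℤ)) + (M * (M + 1ℤ) - + p * (+ p + 1ℤ))
    ≡⟨ collect d M (+ p) ⟩
  (M * (M + 1ℤ)) * d + (M * (M + 1ℤ)) * 1ℤ + (- 1ℤ) * (+ p * + p) + (- 1ℤ) * + p
    ∎
  where
  p : ℕ
  p = winv w 1
  d M S : ℤ
  d = D (suc m) w
  M = + suc (suc m)
  S = ∑ (upTo (suc (suc m))) (λ t → + 𝟙[ p ≤ t ] * + suc t)
  regroup : ∀ d s i → + 2 * (d * s + i) ≡ d * (+ 2 * s) + + 2 * i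
  regroup = solve-∀
  collect : ∀ d m p → d * (m * (m + 1ℤ)) + (m * (m + 1ℤ) - p * (p + 1ℤ))
                    ≡ (m * (m + 1ℤ)) * d + (m * (m + 1ℤ)) * 1ℤ + (- 1ℤ) * (p * p) + (- 1ℤ) * p
  collect = solve-∀

ΣDP-formula : ∀ m → let N = + suc (suc m) in + 12 * ΣDP (suc (suc m)) ≡ (+ 3 * (N * N) + N - + 2) * + (suc (suc m) !)
ΣDP-formula zero    = refl
ΣDP-formula (suc m) = begin
  + 12 * ΣDP (suc n)
    ≡⟨ ℤ.*-assoc (+ 6) (+ 2) (ΣDP (suc n)) ⟩
  + 6 * (+ 2 * ΣDP (suc n))
    ≡⟨ cong (+ 6 *_) (∑-Sym-suc-by n (+ 2) (λ v → D (suc n) v * pos₁ v) _ (∑ext-DP (suc m))) ⟩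
  + 6 * ∑ (Sym n) (λ w → M[M+1] * D n w + M[M+1] * 1ℤ + (- 1ℤ) * (pos₁ w * pos₁ w) + (- 1ℤ) * pos₁ w)
    ≡⟨ cong (+ 6 *_) (∑-linear₄ (Sym n) M[M+1] M[M+1] (- 1ℤ) (- 1ℤ) (D n) (λ _ → 1ℤ) (λ w → pos₁ w * pos₁ w) pos₁) ⟩
  + 6 * (M[M+1] * ΣD n + M[M+1] * ∑ (Sym n) (λ _ → 1ℤ) + (- 1ℤ) * ΣP² n + (- 1ℤ) * ΣP n)
    ≡⟨ cong (λ f → + 6 * (M[M+1] * ΣD n + M[M+1] * f + (- 1ℤ) * ΣP² n + (- 1ℤ) * ΣP n)) (∑-Sym-1 n) ⟩
  + 6 * (M[M+1] * ΣD n + M[M+1] * F + (- 1ℤ) * ΣP² n + (- 1ℤ) * ΣP n)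
    ≡⟨ regroup M[M+1] (ΣD n) F (ΣP² n) (ΣP n) ⟩
  + 3 * M[M+1] * (+ 2 * ΣD n) + + 6 * M[M+1] * F - + 6 * ΣP² n - + 3 * (+ 2 * ΣP n)
    ≡⟨ cong₃ (λ a b c → + 3 * M[M+1] * a + + 6 * M[M+1] * F - b - + 3 * c)
             (ΣD-formula (suc m)) (ΣP²-formula (suc m)) (ΣP-formula (suc m)) ⟩
  + 3 * M[M+1] * (+ suc m * F) + + 6 * M[M+1] * F - (N + 1ℤ) * (+ 2 * N + 1ℤ) * F - + 3 * ((N + 1ℤ) * F)
    ≡⟨ collect (+ m) F ⟩
  (+ 3 * (M * M) + M - + 2) * (M * F)
    ≡⟨ cong ((+ 3 * (M * M) + M - + 2) *_) (+!-suc n) ⟨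
  (+ 3 * (M * M) + M - + 2) * + (suc n !)
    ∎
  where
  n : ℕ
  n = suc (suc m)
  N M M[M+1] F : ℤ
  N = + n
  M = + suc n
  M[M+1] = M * (M + 1ℤ)
  F = + (n !)
  regroup : ∀ k s f pp p → + 6 * (k * s + k * f + (- 1ℤ) * pp + (- 1ℤ) * p)
                         ≡ + 3 * k * (+ 2 * s) + + 6 * k * f - + 6 * pp - + 3 * (+ 2 * p)
  regroup = solve-∀
  collect : ∀ m f → let N = + 2 + m ; M = 1ℤ + N in
            + 3 * (M * (M + 1ℤ)) * ((1ℤ + m) * f) + + 6 * (M * (M + 1ℤ)) * f
              - (N + 1ℤ) * (+ 2 * N + 1ℤ) * f - + 3 * ((N + 1ℤ) * f)
            ≡ (+ 3 * (M * M) + M - + 2) * (M * f)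
  collect = solve-∀

square-+𝟙 : ∀ d q t → (d + + 𝟙[ q ≤ t ]) * (d + + 𝟙[ q ≤ t ]) ≡ (d * d) * 1ℤ + (+ 2 * d + 1ℤ) * + 𝟙[ q ≤ t ]
square-+𝟙 d q t with t <ᵇ q
... | true  = square-+0 d
  where
  square-+0 : ∀ d → (d + + 0) * (d + + 0) ≡ (d * d) * 1ℤ + (+ 2 * d + 1ℤ) * + 0
  square-+0 = solve-∀
... | false = square-+1 d
  where
  square-+1 : ∀ d → (d + + 1) * (d + + 1) ≡ (d * d) * 1ℤ + (+ 2 * d + 1ℤ) * + 1
  square-+1 = solve-∀

∑ext-D² : ∀ m w → SymInvariant (suc m) w → let M = + suc (suc m) ; d = D (suc m) w in
          ∑ext (suc m) w (λ v → D (suc (suc m)) v * D (suc (suc m)) v)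
            ≡ M * (d * d) + (+ 2 * M) * d + (- + 2) * (d * pos₁ w) + M * 1ℤ + (- 1ℤ) * pos₁ w
∑ext-D² m w I = begin
  ∑ext (suc m) w (λ v → D (suc (suc m)) v * D (suc (suc m)) v)
    ≡⟨ ∑ext-cong (suc m) w (λ v → D (suc (suc m)) v * D (suc (suc m)) v) (λ t t≤n →
         trans (cong (λ e → e * e) (Extension.D-extend (suc m) w I t t≤n refl)) (square-+𝟙 d p t)) ⟩
  ∑ (upTo (suc (suc m))) (λ t → (d * d) * 1ℤ + (+ 2 * d + 1ℤ) * + 𝟙[ p ≤ t ])
    ≡⟨ ∑-linear₂ (upTo (suc (suc m))) (d * d) (+ 2 * d + 1ℤ) (λ _ → 1ℤ) (λ t → + 𝟙[ p ≤ t ]) ⟩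
  (d * d) * ∑ (upTo (suc (suc m))) (λ _ → 1ℤ) + (+ 2 * d + 1ℤ) * ∑ (upTo (suc (suc m))) (λ t → + 𝟙[ p ≤ t ])
    ≡⟨ cong₂ (λ a b → (d * d) * a + (+ 2 * d + 1ℤ) * b)
             (∑-upTo-const (suc (suc m)) 1ℤ) (∑-𝟙[≤] (suc (suc m)) p (winv-1≤1+n (suc m) w I)) ⟩
  (d * d) * (1ℤ * M) + (+ 2 * d + 1ℤ) * (M - + p)
    ≡⟨ collect d M (+ p) ⟩
  M * (d * d) + (+ 2 * M) * d + (- + 2) * (d * + p) + M * 1ℤ + (- 1ℤ) * + p
    ∎
  where
  p : ℕ
  p = winv w 1
  d M : ℤ
  d = D (suc m) w
  M = + suc (suc m)
  collect : ∀ d m p → (d * d) * (1ℤ * m) + (+ 2 * d + 1ℤ) * (m - p)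
                    ≡ m * (d * d) + (+ 2 * m) * d + (- + 2) * (d * p) + m * 1ℤ + (- 1ℤ) * p
  collect = solve-∀

ΣD²-formula : ∀ m → let N = + suc (suc m) in
              + 12 * ΣD² (suc (suc m)) ≡ ((N + 1ℤ) + + 3 * ((N - 1ℤ) * (N - 1ℤ))) * + (suc (suc m) !)
ΣD²-formula zero    = refl
ΣD²-formula (suc m) = begin
  + 12 * ΣD² (suc n)
    ≡⟨ cong (+ 12 *_) (ℤ.*-identityˡ _) ⟨
  + 12 * (1ℤ * ΣD² (suc n))
    ≡⟨ cong (+ 12 *_) (∑-Sym-suc-by n 1ℤ (λ v → D (suc n) v * D (suc n) v) _ (λ w I → trans (ℤ.*-identityˡ _) (∑ext-D² (suc m) w I))) ⟩
  + 12 * ∑ (Sym n) (λ w → M * (D n w * D n w) + (+ 2 * M) * D n w + (- + 2) * (D n w * pos₁ w) + M * 1ℤ + (- 1ℤ) * pos₁ w)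
    ≡⟨ cong (+ 12 *_) (∑-linear₅ (Sym n) M (+ 2 * M) (- + 2) M (- 1ℤ)
                                 (λ w → D n w * D n w) (D n) (λ w → D n w * pos₁ w) (λ _ → 1ℤ) pos₁) ⟩
  + 12 * (M * ΣD² n + (+ 2 * M) * ΣD n + (- + 2) * ΣDP n + M * ∑ (Sym n) (λ _ → 1ℤ) + (- 1ℤ) * ΣP n)
    ≡⟨ cong (λ f → + 12 * (M * ΣD² n + (+ 2 * M) * ΣD n + (- + 2) * ΣDP n + M * f + (- 1ℤ) * ΣP n)) (∑-Sym-1 n) ⟩
  + 12 * (M * ΣD² n + (+ 2 * M) * ΣD n + (- + 2) * ΣDP n + M * F + (- 1ℤ) * ΣP n)
    ≡⟨ regroup M (ΣD² n) (ΣD n) (ΣDP n) F (ΣP n) ⟩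
  M * (+ 12 * ΣD² n) + + 12 * M * (+ 2 * ΣD n) - + 2 * (+ 12 * ΣDP n) + + 12 * M * F - + 6 * (+ 2 * ΣP n)
    ≡⟨ cong₄ (λ a b c e → M * a + + 12 * M * b - + 2 * c + + 12 * M * F - + 6 * e)
             (ΣD²-formula m) (ΣD-formula (suc m)) (ΣDP-formula m) (ΣP-formula (suc m)) ⟩
  M * (((N + 1ℤ) + + 3 * ((N - 1ℤ) * (N - 1ℤ))) * F) + + 12 * M * (+ suc m * F)
    - + 2 * ((+ 3 * (N * N) + N - + 2) * F) + + 12 * M * F - + 6 * ((N + 1ℤ) * F)
    ≡⟨ collect (+ m) F ⟩
  ((M + 1ℤ) + + 3 * ((M - 1ℤ) * (M - 1ℤ))) * (M * F)
    ≡⟨ cong (((M + 1ℤ) + + 3 * ((M - 1ℤ) * (M - 1ℤ))) *_) (+!-suc n) ⟨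
  ((M + 1ℤ) + + 3 * ((M - 1ℤ) * (M - 1ℤ))) * + (suc n !)
    ∎
  where
  n : ℕ
  n = suc (suc m)
  N M F : ℤ
  N = + n
  M = + suc n
  F = + (n !)
  regroup : ∀ M q s dp f p → + 12 * (M * q + (+ 2 * M) * s + (- + 2) * dp + M * f + (- 1ℤ) * p)
                           ≡ M * (+ 12 * q) + + 12 * M * (+ 2 * s) - + 2 * (+ 12 * dp) + + 12 * M * f - + 6 * (+ 2 * p)
  regroup = solve-∀
  collect : ∀ m f → let N = + 2 + m ; M = 1ℤ + N in
            M * (((N + 1ℤ) + + 3 * ((N - 1ℤ) * (N - 1ℤ))) * f) + + 12 * M * ((1ℤ + m) * f)
              - + 2 * ((+ 3 * (N * N) + N - + 2) * f) + + 12 * M * f - + 6 * ((N + 1ℤ) * f)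
            ≡ ((M + 1ℤ) + + 3 * ((M - 1ℤ) * (M - 1ℤ))) * (M * f)
  collect = solve-∀

≤-from-difference : ∀ {i j k} → j - i ≡ k → 0ℤ ≤ k → i ≤ j
≤-from-difference {i} {j} j-i≡k 0≤k = ℤ.0≤i-j⇒j≤i (subst (0ℤ ≤_) (sym j-i≡k) 0≤k)

0≤i*j : ∀ {i j} → 0ℤ ≤ i → 0ℤ ≤ j → 0ℤ ≤ i * j
0≤i*j {+ m} {+ n} _ _ = subst (0ℤ ≤_) (ℤ.pos-* m n) (+≤+ z≤n)

0≤i*i : ∀ i → 0ℤ ≤ i * i
0≤i*i (+ m)      = 0≤i*j {+ m} {+ m} (+≤+ z≤n) (+≤+ z≤n)
0≤i*i -[1+ m ]  = subst (0ℤ ≤_) (neg*neg (+ suc m)) (0≤i*i (+ suc m))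
  where
  neg*neg : ∀ i → i * i ≡ (- i) * (- i)
  neg*neg = solve-∀

tangent-line : ∀ y c → + 2 * c * y - c * c ≤ y * y
tangent-line y c = ≤-from-difference (difference y c) (0≤i*i (y - c))
  where
  difference : ∀ y c → y * y - (+ 2 * c * y - c * c) ≡ (y - c) * (y - c)
  difference = solve-∀

cauchy-schwarz₅ : ∀ a b c d e → (a + b + c + d + e) * (a + b + c + d + e) ≤ + 5 * (a * a + b * b + c * c + d * d + e * e)
cauchy-schwarz₅ a b c d e = ≤-from-difference (lagrange a b c d e)
  (sq (a - b) ⊕ sq (a - c) ⊕ sq (a - d) ⊕ sq (a - e) ⊕ sq (b - c) ⊕ sq (b - d) ⊕ sq (b - e) ⊕ sq (c - d) ⊕ sq (c - e) ⊕ sq (d - e))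
  where
  sq = 0≤i*i
  _⊕_ = ℤ.+-mono-≤
  infixl 6 _⊕_
  lagrange : ∀ a b c d e → + 5 * (a * a + b * b + c * c + d * d + e * e) - (a + b + c + d + e) * (a + b + c + d + e)
           ≡ (a - b) * (a - b) + (a - c) * (a - c) + (a - d) * (a - d) + (a - e) * (a - e) + (b - c) * (b - c)
             + (b - d) * (b - d) + (b - e) * (b - e) + (c - d) * (c - d) + (c - e) * (c - e) + (d - e) * (d - e)
  lagrange = solve-∀

-- Pointwise bounds on X²

2*[1+d]C2 : ∀ d → + 2 * + (suc d C 2) ≡ (+ d + 1ℤ) * + d
2*[1+d]C2 zero    = refl
2*[1+d]C2 (suc d) = begin
  + 2 * + (suc (suc d) C 2)                  ≡⟨ cong (λ c → + 2 * + c) (nCk+nC[k+1]≡[n+1]C[k+1] (suc d) 1) ⟨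
  + 2 * + (suc d C 1 ℕ.+ suc d C 2)          ≡⟨ cong (λ c → + 2 * + (c ℕ.+ suc d C 2)) (nC1≡n (suc d)) ⟩
  + 2 * (+ suc d + + (suc d C 2))            ≡⟨ ℤ.*-distribˡ-+ (+ 2) (+ suc d) (+ (suc d C 2)) ⟩
  + 2 * + suc d + + 2 * + (suc d C 2)        ≡⟨ cong (_+_ (+ 2 * + suc d)) (2*[1+d]C2 d) ⟩
  + 2 * (1ℤ + + d) + (+ d + 1ℤ) * + d       ≡⟨ step (+ d) ⟩
  ((1ℤ + + d) + 1ℤ) * (1ℤ + + d)             ∎
  where
  step : ∀ d → + 2 * (1ℤ + d) + (d + 1ℤ) * d ≡ ((1ℤ + d) + 1ℤ) * (1ℤ + d)
  step = solve-∀

2X≡2L-[D+1]D : ∀ n w → + 2 * Xstat n w ≡ + 2 * L n w - (D n w + 1ℤ) * D n w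
2X≡2L-[D+1]D n w = begin
  + 2 * (L n w - + (suc (Dstat n w) C 2))          ≡⟨ ℤ.*-distribˡ-+ (+ 2) (L n w) (- + (suc (Dstat n w) C 2)) ⟩
  + 2 * L n w + + 2 * - + (suc (Dstat n w) C 2)   ≡⟨ cong (_+_ (+ 2 * L n w)) (ℤ.neg-distribʳ-* (+ 2) _) ⟨
  + 2 * L n w - + 2 * + (suc (Dstat n w) C 2)     ≡⟨ cong (λ c → + 2 * L n w - c) (2*[1+d]C2 (Dstat n w)) ⟩
  + 2 * L n w - (D n w + 1ℤ) * D n w               ∎

-- The lower bound is the tangent line of y ↦ 16y² at y = n²/4.  For the upper bound write u = 2D − n:
-- the five numbers 8L − 2n², −u², −2nu, −2u, −2n add up to 4y − n², so Cauchy–Schwarz bounds (4y − n²)²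
-- by five times the sum of their squares, and u⁴ ≤ n²u² because 0 ≤ D ≤ n.
lowerBound upperBound : ℤ → ℤ → ℤ → ℤ
lowerBound l d N = (+ 16 * (N * N)) * l + (- (+ 8 * (N * N))) * (d * d) + (- (+ 8 * (N * N))) * d + (- (N * N * N * N)) * 1ℤ
upperBound l d N = + 320 * (l * l) + (- (+ 144 * (N * N))) * l + (+ 92 * (N * N) + + 80) * (d * d)
                   + (- (+ 8 * (N * N) + + 100 * (N * N * N) + + 80 * N)) * d + (+ 44 * (N * N * N * N) + + 40 * (N * N)) * 1ℤ

lowerBound≤16y² : ∀ l d N → let y = + 2 * l - (d + 1ℤ) * d in lowerBound l d N ≤ + 16 * (y * y)
lowerBound≤16y² l d N = subst₂ _≤_ (tangent-form l d N) (square-form l d) (tangent-line (+ 4 * y) (N * N))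
  where
  y = + 2 * l - (d + 1ℤ) * d
  tangent-form : ∀ l d N → let y = + 2 * l - (d + 1ℤ) * d in
                 + 2 * (N * N) * (+ 4 * y) - (N * N) * (N * N)
                   ≡ (+ 16 * (N * N)) * l + (- (+ 8 * (N * N))) * (d * d) + (- (+ 8 * (N * N))) * d + (- (N * N * N * N)) * 1ℤ
  tangent-form = solve-∀
  square-form : ∀ l d → let y = + 2 * l - (d + 1ℤ) * d in (+ 4 * y) * (+ 4 * y) ≡ + 16 * (y * y)
  square-form = solve-∀

16y²≤upperBound : ∀ l d N → 0ℤ ≤ d → d ≤ N → let y = + 2 * l - (d + 1ℤ) * d in + 16 * (y * y) ≤ upperBound l d N
16y²≤upperBound l d N 0≤d d≤N = ≤-from-difference (decomposition l d N)
  (ℤ.+-mono-≤ (ℤ.i≤j⇒0≤j-i (cauchy-schwarz₅ a (- (u * u)) (- (+ 2 * N * u)) (- (+ 2 * u)) (- (+ 2 * N))))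
              0≤20u²d[N-d])
  where
  a u : ℤ
  a = + 8 * l - + 2 * (N * N)
  u = + 2 * d - N
  0≤20u²d[N-d] : 0ℤ ≤ + 20 * (u * u) * d * (N - d)
  0≤20u²d[N-d] = 0≤i*j {+ 20 * (u * u) * d} (0≤i*j {+ 20 * (u * u)} (0≤i*j {+ 20} (+≤+ z≤n) (0≤i*i u)) 0≤d) (ℤ.i≤j⇒0≤j-i d≤N)
  decomposition : ∀ l d N → let y = + 2 * l - (d + 1ℤ) * d ; a = + 8 * l - + 2 * (N * N) ; u = + 2 * d - N
                                b = - (u * u) ; c = - (+ 2 * N * u) ; e = - (+ 2 * u) ; f = - (+ 2 * N) in
                  + 320 * (l * l) + (- (+ 144 * (N * N))) * l + (+ 92 * (N * N) + + 80) * (d * d)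
                    + (- (+ 8 * (N * N) + + 100 * (N * N * N) + + 80 * N)) * d + (+ 44 * (N * N * N * N) + + 40 * (N * N)) * 1ℤ
                    - + 16 * (y * y)
                    ≡ (+ 5 * (a * a + b * b + c * c + e * e + f * f) - (a + b + c + e + f) * (a + b + c + e + f))
                      + + 20 * (u * u) * d * (N - d)
  decomposition = solve-∀

module _ (n : ℕ) (w : List ℕ) where

  private
    y : ℤ
    y = + 2 * L n w - (D n w + 1ℤ) * D n w

    64X²≡16y² : + 64 * (Xstat n w * Xstat n w) ≡ + 16 * (y * y)
    64X²≡16y² = trans (regroup (Xstat n w)) (cong (λ x → + 16 * (x * x)) (2X≡2L-[D+1]D n w))
      where
      regroup : ∀ x → + 64 * (x * x) ≡ + 16 * ((+ 2 * x) * (+ 2 * x))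
      regroup = solve-∀

  lowerBound≤64X² : lowerBound (L n w) (D n w) (+ n) ≤ + 64 * (Xstat n w * Xstat n w)
  lowerBound≤64X² = subst (lowerBound (L n w) (D n w) (+ n) ≤_) (sym 64X²≡16y²) (lowerBound≤16y² (L n w) (D n w) (+ n))

  64X²≤upperBound : + 64 * (Xstat n w * Xstat n w) ≤ upperBound (L n w) (D n w) (+ n)
  64X²≤upperBound = subst (_≤ upperBound (L n w) (D n w) (+ n)) (sym 64X²≡16y²)
                          (16y²≤upperBound (L n w) (D n w) (+ n) (+≤+ z≤n) (D≤n n w))

∑64X²≡64sumXsq : ∀ n → ∑ (Sym n) (λ w → + 64 * (Xstat n w * Xstat n w)) ≡ + 64 * sumXsq n
∑64X²≡64sumXsq n = ∑-*ˡ (Sym n) (+ 64) (λ w → Xstat n w * Xstat n w)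

moment-lowerBound : ∀ n → let N = + n in
  (+ 16 * (N * N)) * ΣL n + (- (+ 8 * (N * N))) * ΣD² n + (- (+ 8 * (N * N))) * ΣD n + (- (N * N * N * N)) * + (n !)
    ≤ + 64 * sumXsq n
moment-lowerBound n = subst₂ _≤_
  (trans (∑-linear₄ (Sym n) (+ 16 * (N * N)) (- (+ 8 * (N * N))) (- (+ 8 * (N * N))) (- (N * N * N * N))
                    (L n) (λ w → D n w * D n w) (D n) (λ _ → 1ℤ))
         (cong (λ f → (+ 16 * (N * N)) * ΣL n + (- (+ 8 * (N * N))) * ΣD² n + (- (+ 8 * (N * N))) * ΣD n + (- (N * N * N * N)) * f)
               (∑-Sym-1 n)))
  (∑64X²≡64sumXsq n)
  (∑-monoᴬ (SymInvariant-Sym n) (λ w _ → lowerBound≤64X² n w))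
  where
  N : ℤ
  N = + n

moment-upperBound : ∀ n → let N = + n in
  + 64 * sumXsq n
    ≤ + 320 * ΣL² n + (- (+ 144 * (N * N))) * ΣL n + (+ 92 * (N * N) + + 80) * ΣD² n
      + (- (+ 8 * (N * N) + + 100 * (N * N * N) + + 80 * N)) * ΣD n + (+ 44 * (N * N * N * N) + + 40 * (N * N)) * + (n !)
moment-upperBound n = subst₂ _≤_
  (∑64X²≡64sumXsq n)
  (trans (∑-linear₅ (Sym n) (+ 320) (- (+ 144 * (N * N))) (+ 92 * (N * N) + + 80)
                    (- (+ 8 * (N * N) + + 100 * (N * N * N) + + 80 * N)) (+ 44 * (N * N * N * N) + + 40 * (N * N))
                    (λ w → L n w * L n w) (L n) (λ w → D n w * D n w) (D n) (λ _ → 1ℤ))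
         (cong (λ f → + 320 * ΣL² n + (- (+ 144 * (N * N))) * ΣL n + (+ 92 * (N * N) + + 80) * ΣD² n
                      + (- (+ 8 * (N * N) + + 100 * (N * N * N) + + 80 * N)) * ΣD n + (+ 44 * (N * N * N * N) + + 40 * (N * N)) * f)
               (∑-Sym-1 n)))
  (∑-monoᴬ (SymInvariant-Sym n) (λ w _ → 64X²≤upperBound n w))
  where
  N : ℤ
  N = + n

-- Asymptotics

0≤cubic : ∀ (a b c e m : ℕ) → let M = + m in 0ℤ ≤ + a * (M * M * M) + + b * (M * M) + + c * M + + e
0≤cubic a b c e m = ℤ.+-mono-≤ (ℤ.+-mono-≤ (ℤ.+-mono-≤ (0≤i*j {+ a} (+≤+ z≤n) M³) (0≤i*j {+ b} (+≤+ z≤n) M²))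
                                            (0≤i*j {+ c} {M} (+≤+ z≤n) (+≤+ z≤n)))
                               (+≤+ z≤n)
  where
  M : ℤ
  M = + m
  M² : 0ℤ ≤ M * M
  M² = 0≤i*i M
  M³ : 0ℤ ≤ M * M * M
  M³ = 0≤i*j {M * M} {M} M² (+≤+ z≤n)

module Deviation (m : ℕ) where

  n : ℕ
  n = suc (suc m)

  N F deviation : ℤ
  N = + n
  F = + (n !)
  deviation = + 64 * sumXsq n - N * N * N * N * F

  9*deviation≤1200n³n! : + 9 * deviation ≤ + 1200 * (N * N * N) * F
  9*deviation≤1200n³n! = ℤ.≤-trans (ℤ.*-monoˡ-≤-nonNeg (+ 9) (ℤ.+-monoˡ-≤ (- (N * N * N * N * F)) (moment-upperBound n)))
                           (ℤ.≤-trans (ℤ.≤-reflexive evaluate) (ℤ.i-j≤i _ _ {{nonNegative slack≥0}}))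
    where
    slack≥0 : 0ℤ ≤ F * (+ 1087 * (+ m * + m * + m) + + 5730 * (+ m * + m) + + 10016 * + m + + 5568)
    slack≥0 = 0≤i*j {F} (+≤+ z≤n) (0≤cubic 1087 5730 10016 5568 m)
    regroup : ∀ N sll sl sdd sd f →
      + 9 * (+ 320 * sll + (- (+ 144 * (N * N))) * sl + (+ 92 * (N * N) + + 80) * sdd
             + (- (+ 8 * (N * N) + + 100 * (N * N * N) + + 80 * N)) * sd + (+ 44 * (N * N * N * N) + + 40 * (N * N)) * f
             - N * N * N * N * f)
      ≡ + 20 * (+ 144 * sll) + (- (+ 324 * (N * N))) * (+ 4 * sl) + (+ 69 * (N * N) + + 60) * (+ 12 * sdd)
        + (- (+ 36 * (N * N) + + 450 * (N * N * N) + + 360 * N)) * (+ 2 * sd) + + 9 * (+ 43 * (N * N * N * N) + + 40 * (N * N)) * f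
    regroup = solve-∀
    collect : ∀ x f → let N = + 2 + x in
      + 20 * ((+ 2 * N * (N - 1ℤ) * (+ 2 * N + + 5) + + 9 * (N * N) * ((N - 1ℤ) * (N - 1ℤ))) * f)
        + (- (+ 324 * (N * N))) * (N * (N - 1ℤ) * f)
        + (+ 69 * (N * N) + + 60) * (((N + 1ℤ) + + 3 * ((N - 1ℤ) * (N - 1ℤ))) * f)
        + (- (+ 36 * (N * N) + + 450 * (N * N * N) + + 360 * N)) * ((1ℤ + x) * f)
        + + 9 * (+ 43 * (N * N * N * N) + + 40 * (N * N)) * f
      ≡ + 1200 * (N * N * N) * f - f * (+ 1087 * (x * x * x) + + 5730 * (x * x) + + 10016 * x + + 5568)
    collect = solve-∀
    evaluate : + 9 * (+ 320 * ΣL² n + (- (+ 144 * (N * N))) * ΣL n + (+ 92 * (N * N) + + 80) * ΣD² n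
                      + (- (+ 8 * (N * N) + + 100 * (N * N * N) + + 80 * N)) * ΣD n
                      + (+ 44 * (N * N * N * N) + + 40 * (N * N)) * F - N * N * N * N * F)
               ≡ + 1200 * (N * N * N) * F - F * (+ 1087 * (+ m * + m * + m) + + 5730 * (+ m * + m) + + 10016 * + m + + 5568)
    evaluate = begin
      _ ≡⟨ regroup N (ΣL² n) (ΣL n) (ΣD² n) (ΣD n) F ⟩
      _ ≡⟨ cong₄ (λ a b c e → + 20 * a + (- (+ 324 * (N * N))) * b + (+ 69 * (N * N) + + 60) * c
                              + (- (+ 36 * (N * N) + + 450 * (N * N * N) + + 360 * N)) * e
                              + + 9 * (+ 43 * (N * N * N * N) + + 40 * (N * N)) * F)
                 (ΣL²-formula n) (ΣL-formula n) (ΣD²-formula m) (ΣD-formula (suc m)) ⟩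
      _ ≡⟨ collect (+ m) F ⟩
      _ ∎

  -1200n³n!≤9*deviation : - (+ 1200 * (N * N * N) * F) ≤ + 9 * deviation
  -1200n³n!≤9*deviation = ℤ.≤-trans (ℤ.≤-trans (ℤ.i≤i+j _ _ {{nonNegative slack≥0}}) (ℤ.≤-reflexive (sym evaluate)))
                                    (ℤ.*-monoˡ-≤-nonNeg (+ 9) (ℤ.+-monoˡ-≤ (- (N * N * N * N * F)) (moment-lowerBound n)))
    where
    slack≥0 : 0ℤ ≤ F * (+ 1158 * (N * N * N) + + 12 * (N * N))
    slack≥0 = 0≤i*j {F} (+≤+ z≤n) (ℤ.+-mono-≤ (0≤i*j {+ 1158} {N * N * N} (+≤+ z≤n) (0≤i*j {N * N} {N} (0≤i*i N) (+≤+ z≤n)))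
                                              (0≤i*j {+ 12} {N * N} (+≤+ z≤n) (0≤i*i N)))
    regroup : ∀ N sl sdd sd f →
      + 9 * ((+ 16 * (N * N)) * sl + (- (+ 8 * (N * N))) * sdd + (- (+ 8 * (N * N))) * sd + (- (N * N * N * N)) * f
             - N * N * N * N * f)
      ≡ (+ 36 * (N * N)) * (+ 4 * sl) + (- (+ 6 * (N * N))) * (+ 12 * sdd) + (- (+ 36 * (N * N))) * (+ 2 * sd)
        + (- (+ 18 * (N * N * N * N))) * f
    regroup = solve-∀
    collect : ∀ x f → let N = + 2 + x in
      (+ 36 * (N * N)) * (N * (N - 1ℤ) * f) + (- (+ 6 * (N * N))) * (((N + 1ℤ) + + 3 * ((N - 1ℤ) * (N - 1ℤ))) * f)
        + (- (+ 36 * (N * N))) * ((1ℤ + x) * f) + (- (+ 18 * (N * N * N * N))) * f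
      ≡ - (+ 1200 * (N * N * N) * f) + f * (+ 1158 * (N * N * N) + + 12 * (N * N))
    collect = solve-∀
    evaluate : + 9 * ((+ 16 * (N * N)) * ΣL n + (- (+ 8 * (N * N))) * ΣD² n + (- (+ 8 * (N * N))) * ΣD n
                      + (- (N * N * N * N)) * F - N * N * N * N * F)
               ≡ - (+ 1200 * (N * N * N) * F) + F * (+ 1158 * (N * N * N) + + 12 * (N * N))
    evaluate = begin
      _ ≡⟨ regroup N (ΣL n) (ΣD² n) (ΣD n) F ⟩
      _ ≡⟨ cong₃ (λ a b c → (+ 36 * (N * N)) * a + (- (+ 6 * (N * N))) * b + (- (+ 36 * (N * N))) * c
                            + (- (+ 18 * (N * N * N * N))) * F)
                 (ΣL-formula n) (ΣD²-formula m) (ΣD-formula (suc m)) ⟩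
      _ ≡⟨ collect (+ m) F ⟩
      _ ∎

+n^4 : ∀ n → + (n ℕ.^ 4) ≡ + n * + n * + n * + n
+n^4 n = begin
  + (n ℕ.^ 4)                       ≡⟨ ℤ.pos-* n (n ℕ.^ 3) ⟩
  + n * + (n ℕ.^ 3)                 ≡⟨ cong (+ n *_) (ℤ.pos-* n (n ℕ.^ 2)) ⟩
  + n * (+ n * + (n ℕ.^ 2))         ≡⟨ cong (λ x → + n * (+ n * x)) (ℤ.pos-* n (n ℕ.^ 1)) ⟩
  + n * (+ n * (+ n * + (n ℕ.^ 1))) ≡⟨ cong (λ x → + n * (+ n * (+ n * x))) (ℤ.pos-* n 1) ⟩
  + n * (+ n * (+ n * (+ n * 1ℤ))) ≡⟨ reassociate (+ n) ⟩
  + n * + n * + n * + n             ∎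
  where
  reassociate : ∀ x → x * (x * (x * (x * 1ℤ))) ≡ x * x * x * x
  reassociate = solve-∀

threshold : ∀ e d n → 3 ℕ.* suc d ℕ.≤ n → + 1200 * + suc d ≤ + 576 * +[1+ e ] * + n
threshold e d n 3[d+1]≤n = subst₂ _≤_ (ℤ.pos-* 1200 (suc d))
                                     (trans (ℤ.pos-* (576 ℕ.* suc e) n) (cong (_* + n) (ℤ.pos-* 576 (suc e))))
  (+≤+ (ℕ.≤-trans (ℕ.*-monoˡ-≤ (suc d) (ℕ.m≤m+n 1200 528))
       (ℕ.≤-trans (ℕ.≤-reflexive (ℕ.*-assoc 576 3 (suc d)))
       (ℕ.≤-trans (ℕ.*-monoʳ-≤ 576 3[d+1]≤n)
                  (ℕ.*-monoˡ-≤ n (ℕ.m≤m*n 576 (suc e)))))))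

-- 9T ≤ 1200n³F and 1200(d+1) ≤ 576En give 9T(d+1) ≤ 1200n³F(d+1) ≤ 576En⁴F = 9·64En⁴F.
cancel-9 : ∀ (T N F E : ℤ) (d : ℕ) → 0ℤ ≤ N → 0ℤ ≤ F →
           + 9 * T ≤ + 1200 * (N * N * N) * F → + 1200 * + suc d ≤ + 576 * E * N →
           T * + suc d ≤ E * (N * N * N * N) * (+ 64 * F)
cancel-9 T N F E d 0≤N 0≤F 9T≤ 1200[d+1]≤ = ℤ.*-cancelˡ-≤-pos (T * + suc d) (E * (N * N * N * N) * (+ 64 * F)) (+ 9)
  (ℤ.≤-trans (ℤ.≤-reflexive (sym (ℤ.*-assoc (+ 9) T (+ suc d))))
  (ℤ.≤-trans (ℤ.*-monoʳ-≤-nonNeg (+ suc d) 9T≤)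
             (≤-from-difference (factor N F (+ suc d) E) (0≤i*j {N * N * N * F} 0≤N³F (ℤ.i≤j⇒0≤j-i 1200[d+1]≤)))))
  where
  0≤N³F : 0ℤ ≤ N * N * N * F
  0≤N³F = 0≤i*j {N * N * N} (0≤i*j {N * N} (0≤i*i N) 0≤N) 0≤F
  factor : ∀ N F D E → + 9 * (E * (N * N * N * N) * (+ 64 * F)) - + 1200 * (N * N * N) * F * D
                     ≡ N * N * N * F * (+ 576 * E * N - + 1200 * D)
  factor = solve-∀

∣q∣≤x : ∀ (q x : ℚ) → q ℚ.≤ x → ℚ.- q ℚ.≤ x → ℚ.∣ q ∣ ℚ.≤ x
∣q∣≤x q x q≤x -q≤x with ℚ.∣p∣≡p∨∣p∣≡-p q
... | inj₁ ∣q∣≡q  = subst (ℚ._≤ x) (sym ∣q∣≡q) q≤x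
... | inj₂ ∣q∣≡-q = subst (ℚ._≤ x) (sym ∣q∣≡-q) -q≤x

toℚᵘ-/ : ∀ i d .{{_ : ℕ.NonZero d}} → toℚᵘ (i ℚ./ d) ℚᵘ.≃ mkℚᵘ i (ℕ.pred d)
toℚᵘ-/ i (suc d) = ℚ.toℚᵘ-fromℚᵘ (mkℚᵘ i d)

module Conclusion (m e d : ℕ) (ε : ℚ) (ε≃ : toℚᵘ ε ℚᵘ.≃ mkℚᵘ +[1+ e ] d) (3[d+1]≤n : 3 ℕ.* suc d ℕ.≤ suc (suc m)) where
  open Deviation m

  private
    k : ℕ
    k = ℕ.pred (n !)

    F≡1+k : F ≡ + suc k
    F≡1+k = cong +_ (sym (ℕ.suc-pred (n !) {{n ℕ.!≢0}}))

    E : ℤ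
    E = +[1+ e ]

    Q X : ℚᵘ
    Q = mkℚᵘ (sumXsq n) k ℚᵘ.+ ℚᵘ.- mkℚᵘ (+ (n ℕ.^ 4)) 63
    X = mkℚᵘ E d ℚᵘ.* mkℚᵘ (+ (n ℕ.^ 4)) 0

    numerator : sumXsq n * + 64 + (- + (n ℕ.^ 4)) * + suc k ≡ deviation
    numerator = begin
      sumXsq n * + 64 + (- + (n ℕ.^ 4)) * + suc k ≡⟨ cong₂ (λ a b → sumXsq n * + 64 + (- a) * b) (+n^4 n) (sym F≡1+k) ⟩
      sumXsq n * + 64 + (- (N * N * N * N)) * F  ≡⟨ rearrange (sumXsq n) N F ⟩
      deviation                                   ∎
      where
      rearrange : ∀ S N F → S * + 64 + (- (N * N * N * N)) * F ≡ + 64 * S - N * N * N * N * F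
      rearrange = solve-∀

    bound : E * + (n ℕ.^ 4) * + suc (63 ℕ.+ k ℕ.* 64) ≡ E * (N * N * N * N) * (+ 64 * F)
    bound = cong₂ (λ a b → E * a * b) (+n^4 n) (trans (ℤ.pos-* (suc k) 64) (trans (cong (_* + 64) (sym F≡1+k)) (ℤ.*-comm F (+ 64))))

    d+1 : + suc (d ℕ.* 1) ≡ + suc d
    d+1 = cong (λ x → + suc x) (ℕ.*-identityʳ d)

    Q≤X : Q ℚᵘ.≤ X
    Q≤X = *≤* (subst₂ _≤_ (sym (cong₂ _*_ numerator d+1)) (sym bound)
                 (cancel-9 deviation N F E d (+≤+ z≤n) (+≤+ z≤n) 9*deviation≤1200n³n! (threshold e d n 3[d+1]≤n)))

    -Q≤X : ℚᵘ.- Q ℚᵘ.≤ X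
    -Q≤X = *≤* (subst₂ _≤_ (sym (cong₂ _*_ (cong -_ numerator) d+1)) (sym bound)
                  (cancel-9 (- deviation) N F E d (+≤+ z≤n) (+≤+ z≤n) 9*-deviation≤ (threshold e d n 3[d+1]≤n)))
      where
      9*-deviation≤ : + 9 * - deviation ≤ + 1200 * (N * N * N) * F
      9*-deviation≤ = subst₂ _≤_ (ℤ.neg-distribʳ-* (+ 9) deviation) (ℤ.neg-involutive _) (ℤ.neg-mono-≤ -1200n³n!≤9*deviation)

    q x : ℚ
    q = EXsq n ℚ.- + (n ℕ.^ 4) ℚ./ 64
    x = ε ℚ.* (+ (n ℕ.^ 4) ℚ./ 1)

    q≃Q : toℚᵘ q ℚᵘ.≃ Q
    q≃Q = ℚᵘ.≃-trans (ℚ.toℚᵘ-homo-+ (EXsq n) (ℚ.- (+ (n ℕ.^ 4) ℚ./ 64)))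
            (ℚᵘ.+-cong (toℚᵘ-/ (sumXsq n) (n !) {{n ℕ.!≢0}})
                       (ℚᵘ.≃-trans (ℚ.toℚᵘ-homo‿- (+ (n ℕ.^ 4) ℚ./ 64)) (ℚᵘ.-‿cong (toℚᵘ-/ (+ (n ℕ.^ 4)) 64))))

    x≃X : toℚᵘ x ℚᵘ.≃ X
    x≃X = ℚᵘ.≃-trans (ℚ.toℚᵘ-homo-* ε (+ (n ℕ.^ 4) ℚ./ 1)) (ℚᵘ.*-cong ε≃ (toℚᵘ-/ (+ (n ℕ.^ 4)) 1))

  ∣EXsq-n⁴/64∣≤εn⁴ : ℚ.∣ EXsq n ℚ.- + (n ℕ.^ 4) ℚ./ 64 ∣ ℚ.≤ ε ℚ.* (+ (n ℕ.^ 4) ℚ./ 1)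
  ∣EXsq-n⁴/64∣≤εn⁴ = ∣q∣≤x q x
    (ℚ.toℚᵘ-cancel-≤ (ℚᵘ.≤-respˡ-≃ (ℚᵘ.≃-sym q≃Q) (ℚᵘ.≤-respʳ-≃ (ℚᵘ.≃-sym x≃X) Q≤X)))
    (ℚ.toℚᵘ-cancel-≤ (ℚᵘ.≤-respˡ-≃ (ℚᵘ.≃-sym (ℚᵘ.≃-trans (ℚ.toℚᵘ-homo‿- q) (ℚᵘ.-‿cong q≃Q)))
                                   (ℚᵘ.≤-respʳ-≃ (ℚᵘ.≃-sym x≃X) -Q≤X)))

lemma2p2 : (ε : ℚ) → 0ℚ ℚ.< ε → ∃[ N ] ((n : ℕ) → N ℕ.≤ n →
             ℚ.∣ EXsq n ℚ.- (+ (n ℕ.^ 4)) ℚ./ 64 ∣ ℚ.≤ ε ℚ.* ((+ (n ℕ.^ 4)) ℚ./ 1))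
lemma2p2 (mkℚ (+ 0)      _ _) (ℚ.*<* (+<+ ()))
lemma2p2 (mkℚ -[1+ _ ]   _ _) (ℚ.*<* ())
lemma2p2 ε@(mkℚ +[1+ e ] d _) _ = 2 ℕ.+ 3 ℕ.* suc d , bound
  where
  bound : (n : ℕ) → 2 ℕ.+ 3 ℕ.* suc d ℕ.≤ n → ℚ.∣ EXsq n ℚ.- (+ (n ℕ.^ 4)) ℚ./ 64 ∣ ℚ.≤ ε ℚ.* ((+ (n ℕ.^ 4)) ℚ./ 1)
  bound (suc (suc m)) (s≤s (s≤s 3[d+1]≤m)) =
    Conclusion.∣EXsq-n⁴/64∣≤εn⁴ m e d ε ℚᵘ.≃-refl (ℕ.m≤n⇒m≤1+n (ℕ.m≤n⇒m≤1+n 3[d+1]≤m))
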